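{- Let $k \geq 3$ and let $\mathcal{T}$ be a tree containing a tripartition $A|B|C$ with $|A|, |B|, |C| \geq 2$ and $|C| < k$. Let $\mathcal{T}'$ be the result of linearizing the $C$ subtree. Then $g_k(\mathcal{T}') \geq g_k(\mathcal{T})$ and $\mathcal{T}'$ has fewer cherries than $\mathcal{T}$.
   Context: A tree (unrooted binary phylogenetic $X$-tree) is a finite unrooted tree in which every internal vertex has degree 3 and whose leaves are bijectively labelled by a finite set $X$ of taxa. A character on $X$ is a partition of $X$ into non-empty blocks (states); it is convex on $\mathcal{T}$ if the minimal subtrees of $\mathcal{T}$ spanning distinct states are vertex-disjoint. $g_k(\mathcal{T})$ is the number of convex characters on $\mathcal{T}$ all of whose states have at least $k$ taxa. Two taxa form a cherry if they have a common neighbour. A tripartition $A|B|C$ of $X$ is contained in $\mathcal{T}$ if there is a degree-3 vertex $u$ such that $A$, $B$, $C$ are the taxa sets of the three components of $\mathcal{T}$ minus $u$. Linearizing the $C$ subtree: delete $u$ and the component containing $C$, and join the vertex of the $A$-component formerly adjacent to $u$ to the vertex of the $B$-component formerly adjacent to $u$ by a path of $|C|$ new vertices, each of which receives one new pendant leaf, these $|C|$ leaves being labelled bijectively by $C$ (i.e. a caterpillar on $C$ is inserted between the $A$ and $B$ subtrees). -}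

module Defs where

open import Data.Nat using (ℕ; zero; suc; _≡ᵇ_; _<ᵇ_; _≤_; _<_)
open import Data.Bool using (Bool; true; false; _∧_; _∨_; not; if_then_else_)
open import Data.Fin using (Fin; toℕ)
open import Data.List using (List; []; _∷_; map; concatMap; allFin; length; filterᵇ)
open import Data.Bool.ListAction using (any; all)
open import Data.Vec using (Vec; lookup) renaming ([] to []v; _∷_ to _∷v_)
open import Data.Product using (Σ; ∃; _×_; _,_)
open import Data.Sum using (_⊎_)
import Data.Empty
open import Relation.Binary.PropositionalEquality using (_≡_)

countᵇ : {A : Set} → (A → Bool) → List A → ℕ
countᵇ p xs = length (filterᵇ p xs)

_=F_ : {n : ℕ} → Fin n → Fin n → Bool
x =F y = toℕ x ≡ᵇ toℕ y

elemF : {n : ℕ} → Fin n → List (Fin n) → Bool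
elemF v xs = any (v =F_) xs

_⇒ᵇ_ : Bool → Bool → Bool
a ⇒ᵇ b = not a ∨ b

allVecs : {A : Set} → List A → (l : ℕ) → List (Vec A l)
allVecs xs zero = []v ∷ []
allVecs xs (suc l) = concatMap (λ x → map (x ∷v_) (allVecs xs l)) xs

allLists : {A : Set} → List A → ℕ → List (List A)
allLists xs zero = [] ∷ []
allLists xs (suc l) = [] ∷ concatMap (λ x → map (x ∷_) (allLists xs l)) xs

-- Leaf-labelled graphs on vertex set Fin n, taxa X = Fin m

record LGraph (m : ℕ) : Set where
  field
    n    : ℕ
    adj  : Fin n → Fin n → Bool
    leaf : Fin m → Fin n
open LGraph public

module _ {m : ℕ} (G : LGraph m) where

  vertices : List (Fin (n G))
  vertices = allFin (n G)

  degree : Fin (n G) → ℕ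
  degree v = countᵇ (adj G v) vertices

  chain : List (Fin (n G)) → Bool
  chain [] = true
  chain (x ∷ []) = true
  chain (x ∷ y ∷ xs) = adj G x y ∧ chain (y ∷ xs)

  distinct : List (Fin (n G)) → Bool
  distinct [] = true
  distinct (x ∷ xs) = not (elemF x xs) ∧ distinct xs

  lastIs : Fin (n G) → Fin (n G) → List (Fin (n G)) → Bool
  lastIs t x [] = x =F t
  lastIs t x (y ∷ ys) = lastIs t y ys

  isPath : Fin (n G) → Fin (n G) → List (Fin (n G)) → Bool
  isPath s t [] = false
  isPath s t (x ∷ xs) = (x =F s) ∧ lastIs t x xs ∧ chain (x ∷ xs) ∧ distinct (x ∷ xs)

  -- all candidate vertex sequences of length ≤ n (every path is among them)
  candidates : List (List (Fin (n G)))
  candidates = allLists vertices (n G)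

  onPath : Fin (n G) → Fin (n G) → Fin (n G) → Bool
  onPath v s t = any (λ p → isPath s t p ∧ elemF v p) candidates

  reachAvoiding : Fin (n G) → Fin (n G) → Fin (n G) → Bool
  reachAvoiding u a w = any (λ p → isPath a w p ∧ not (elemF u p)) candidates

  -- Unrooted binary phylogenetic X-tree

  record IsTree : Set where
    field
      symmetric   : ∀ u v → adj G u v ≡ adj G v u
      irreflexive : ∀ v → adj G v v ≡ false
      connected   : ∀ u v → ∃ λ p → isPath u v p ≡ true
      acyclic     : ∀ s t p → isPath s t p ≡ true → 3 ≤ length p → adj G s t ≡ false
      degrees     : ∀ v → degree v ≡ 1 ⊎ degree v ≡ 3
      leaf-inj    : ∀ x y → leaf G x ≡ leaf G y → x ≡ y
      leaf-deg1   : ∀ x → degree (leaf G x) ≡ 1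
      deg1-leaf   : ∀ v → degree v ≡ 1 → ∃ λ x → leaf G x ≡ v

  -- Characters: partitions of X, represented by their equivalence
  -- relation as an m × m Boolean matrix.

  Char : Set
  Char = Vec (Vec Bool m) m

  rel : Char → Fin m → Fin m → Bool
  rel M x y = lookup (lookup M x) y

  taxa : List (Fin m)
  taxa = allFin m

  isEquivalence : Char → Bool
  isEquivalence M =
    all (λ x → rel M x x) taxa ∧
    all (λ x → all (λ y → rel M x y ⇒ᵇ rel M y x) taxa) taxa ∧
    all (λ x → all (λ y → all (λ z → (rel M x y ∧ rel M y z) ⇒ᵇ rel M x z) taxa) taxa) taxa

  -- v lies in the minimal subtree spanning the state (block) of taxon x
  inSpan : Char → Fin m → Fin (n G) → Bool
  inSpan M x v = any (λ s → any (λ t → rel M x s ∧ rel M x t ∧ onPath v (leaf G s) (leaf G t)) taxa) taxa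

  isConvex : Char → Bool
  isConvex M = all (λ x → all (λ y → not (rel M x y) ⇒ᵇ
                 all (λ v → not (inSpan M x v ∧ inSpan M y v)) vertices) taxa) taxa

  statesAtLeast : ℕ → Char → Bool
  statesAtLeast k M = all (λ x → (k <ᵇ suc (countᵇ (rel M x) taxa))) taxa

  allChars : List Char
  allChars = allVecs (allVecs (true ∷ false ∷ []) m) m

  g : ℕ → ℕ
  g k = countᵇ (λ M → isEquivalence M ∧ isConvex M ∧ statesAtLeast k M) allChars

  cherries : ℕ
  cherries = countᵇ isCherry (concatMap (λ x → map (x ,_) taxa) taxa)
    where
    isCherry : Fin m × Fin m → Bool
    isCherry (x , y) = (toℕ x <ᵇ toℕ y) ∧
                       any (λ w → adj G w (leaf G x) ∧ adj G w (leaf G y)) vertices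

card : {m : ℕ} → (Fin m → Bool) → ℕ
card {m} S = countᵇ S (allFin m)

record ContainsTripartition {m : ℕ} (T : LGraph m) (u a b c : Fin (n T))
         (A B C : Fin m → Bool) : Set where
  field
    deg-u  : degree T u ≡ 3
    adj-a  : adj T u a ≡ true
    adj-b  : adj T u b ≡ true
    adj-c  : adj T u c ≡ true
    a≢b    : (a =F b) ≡ false
    a≢c    : (a =F c) ≡ false
    b≢c    : (b =F c) ≡ false
    A-comp : ∀ x → A x ≡ reachAvoiding T u a (leaf T x)
    B-comp : ∀ x → B x ≡ reachAvoiding T u b (leaf T x)
    C-comp : ∀ x → C x ≡ reachAvoiding T u c (leaf T x)

-- T' is (up to isomorphism) the result of linearizing the C subtree of T
-- at u: u and the component of T − u containing C are deleted, the kept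
-- vertices (components of a and b) keep their adjacencies, and a path
-- p₀ … p_{|C|-1} of new vertices is inserted with a ~ p₀ and
-- b ~ p_{|C|-1}, each pᵢ carrying a new pendant leaf qᵢ labelled by the
-- taxon σ i, where σ is a bijection from Fin |C| onto C.
-- The maps φ, p, q together form a bijection from the vertices of this
-- constructed graph onto the vertices of T', preserving adjacency and
-- leaf labels.

kept : {m : ℕ} (T : LGraph m) (u a b : Fin (n T)) → Fin (n T) → Bool
kept T u a b v = reachAvoiding T u a v ∨ reachAvoiding T u b v

record IsLinearization {m : ℕ} (T : LGraph m) (u a b : Fin (n T))
         (C : Fin m → Bool) (T' : LGraph m) : Set where
  K : Fin (n T) → Bool
  K = kept T u a b
  field
    σ        : Fin (card C) → Fin m
    σ-inj    : ∀ i j → σ i ≡ σ j → i ≡ j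
    σ-in-C   : ∀ i → C (σ i) ≡ true
    σ-onto   : ∀ x → C x ≡ true → ∃ λ i → σ i ≡ x
    φ        : Fin (n T) → Fin (n T')
    p        : Fin (card C) → Fin (n T')
    q        : Fin (card C) → Fin (n T')
    φ-inj    : ∀ v w → K v ≡ true → K w ≡ true → φ v ≡ φ w → v ≡ w
    p-inj    : ∀ i j → p i ≡ p j → i ≡ j
    q-inj    : ∀ i j → q i ≡ q j → i ≡ j
    φ≢p      : ∀ v i → K v ≡ true → φ v ≡ p i → Data.Empty.⊥
    φ≢q      : ∀ v i → K v ≡ true → φ v ≡ q i → Data.Empty.⊥
    p≢q      : ∀ i j → p i ≡ q j → Data.Empty.⊥
    cover    : ∀ w → (∃ λ v → K v ≡ true × φ v ≡ w) ⊎ (∃ λ i → p i ≡ w) ⊎ (∃ λ i → q i ≡ w)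
    adj'-sym : ∀ w w' → adj T' w w' ≡ adj T' w' w
    adj'-φφ  : ∀ v w → K v ≡ true → K w ≡ true → adj T' (φ v) (φ w) ≡ adj T v w
    adj'-φp  : ∀ v i → K v ≡ true → adj T' (φ v) (p i) ≡
                 (((v =F a) ∧ (toℕ i ≡ᵇ 0)) ∨ ((v =F b) ∧ (suc (toℕ i) ≡ᵇ card C)))
    adj'-φq  : ∀ v i → K v ≡ true → adj T' (φ v) (q i) ≡ false
    adj'-pp  : ∀ i j → adj T' (p i) (p j) ≡
                 ((suc (toℕ i) ≡ᵇ toℕ j) ∨ (suc (toℕ j) ≡ᵇ toℕ i))
    adj'-pq  : ∀ i j → adj T' (p i) (q j) ≡ (i =F j)
    adj'-qq  : ∀ i j → adj T' (q i) (q j) ≡ false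
    leaf'-old : ∀ x → C x ≡ false → leaf T' x ≡ φ (leaf T x)
    leaf'-new : ∀ i → leaf T' (σ i) ≡ q i

module Submission where

-- Let u be the centre of the tripartition and φ the embedding of the A- and B-components of T
-- into T'. The new leaves of T' hang off distinct path vertices and φ preserves adjacency, so
-- every cherry of T' is a cherry of T; and a longest path ending with c u shows that the C-branch
-- of T contains a cherry, which is destroyed by the caterpillar.
-- Now let M be convex on T with all states of size at least k > |C|. A state meeting C also
-- meets A ∪ B, so its span contains u; by convexity C lies inside a single state. Every other
-- state avoids C, hence lies within the A- or the B-component (else its span would contain u as
-- well). The image of such a component in T' is left only through one edge φ(a) p₀ (or
-- φ(b) p_{|C|-1}), so a T'-path through a vertex of the image comes from a T-path through its
-- preimage, and the spans of distinct states remain disjoint in T'.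

open import Data.Nat using (ℕ; zero; suc; pred; _+_; _≤_; _<_; z≤n; s≤s; _≡ᵇ_; _<ᵇ_; >-nonZero)
open import Data.Nat.Properties hiding (_≟_)
open import Data.Bool using (Bool; true; false; _∧_; _∨_; not; T)
open import Data.Bool.Properties using (T-≡; ∧-conicalˡ; ∧-conicalʳ)
open import Function using (id; _∘_; Equivalence)
open import Relation.Nullary.Decidable using (T?)
open import Data.Bool.ListAction using (any; all)
open import Data.Fin using (Fin; toℕ; fromℕ<; _≟_) renaming (zero to fz; suc to fs)
open import Data.Fin.Properties using (toℕ-injective; toℕ-fromℕ<)
open import Data.List using (List; []; _∷_; map; length; allFin; tabulate; _++_; concatMap)
open import Data.List.Relation.Unary.Any using (here; there)
open import Data.List.Membership.Propositional using (_∈_; lose)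
open import Data.List.Membership.Propositional.Properties
  using (∈-concatMap⁺; ∈-map⁺; ∈-map⁻; ∈-allFin; ∈-++⁺ˡ; ∈-++⁺ʳ; ∈-++⁻; ∈-∃++)
import Data.List.Properties as LP
open import Data.Product using (Σ; ∃; _×_; _,_; proj₁; proj₂)
open import Data.Sum using (_⊎_; inj₁; inj₂)
open import Data.Empty using (⊥; ⊥-elim)
open import Relation.Nullary using (yes; no; ¬_)
open import Relation.Binary using (tri<; tri≈; tri>)
open import Relation.Binary.PropositionalEquality hiding (isEquivalence)
open import Defs

∧-true⁻ˡ : ∀ {a b} → (a ∧ b) ≡ true → a ≡ true
∧-true⁻ˡ {a} {b} = ∧-conicalˡ a b
∧-true⁻ʳ : ∀ {a b} → (a ∧ b) ≡ true → b ≡ true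
∧-true⁻ʳ {a} {b} = ∧-conicalʳ a b
∧-true⁺ : ∀ {a b} → a ≡ true → b ≡ true → (a ∧ b) ≡ true
∧-true⁺ refl refl = refl
∨-true⁻ : ∀ {a b} → (a ∨ b) ≡ true → a ≡ true ⊎ b ≡ true
∨-true⁻ {true} _ = inj₁ refl
∨-true⁻ {false} e = inj₂ e
∨-true⁺ˡ : ∀ {a b} → a ≡ true → (a ∨ b) ≡ true
∨-true⁺ˡ refl = refl
∨-true⁺ʳ : ∀ {a b} → b ≡ true → (a ∨ b) ≡ true
∨-true⁺ʳ {true} _ = refl
∨-true⁺ʳ {false} e = e
not-true⁻ : ∀ {a} → not a ≡ true → a ≡ false
not-true⁻ {false} _ = refl
not-true⁺ : ∀ {a} → a ≡ false → not a ≡ true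
not-true⁺ refl = refl
true≢false : ∀ {a} → a ≡ true → a ≡ false → ⊥
true≢false refl ()
⇒ᵇ-true⁻ : ∀ {a b} → (a ⇒ᵇ b) ≡ true → a ≡ true → b ≡ true
⇒ᵇ-true⁻ {true} e refl = e
⇒ᵇ-true⁺ : ∀ {a b} → (a ≡ true → b ≡ true) → (a ⇒ᵇ b) ≡ true
⇒ᵇ-true⁺ {true} f = f refl
⇒ᵇ-true⁺ {false} f = refl
true-or-false : ∀ (a : Bool) → a ≡ true ⊎ a ≡ false
true-or-false true = inj₁ refl
true-or-false false = inj₂ refl

≡ᵇ-true⇒≡ : ∀ m n → (m ≡ᵇ n) ≡ true → m ≡ n
≡ᵇ-true⇒≡ m n e = ≡ᵇ⇒≡ m n (Equivalence.from T-≡ e)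

=F⇒≡ : ∀ {N} {x y : Fin N} → (x =F y) ≡ true → x ≡ y
=F⇒≡ {x = x} {y} e = toℕ-injective (≡ᵇ-true⇒≡ (toℕ x) (toℕ y) e)
≡⇒=F : ∀ {N} {x y : Fin N} → x ≡ y → (x =F y) ≡ true
≡⇒=F {x = x} {y} e = Equivalence.to T-≡ (≡⇒≡ᵇ (toℕ x) (toℕ y) (cong toℕ e))
≢⇒=F-false : ∀ {N} {x y : Fin N} → (x ≡ y → ⊥) → (x =F y) ≡ false
≢⇒=F-false {x = x} {y} ne with true-or-false (x =F y)
... | inj₁ e = ⊥-elim (ne (=F⇒≡ e))
... | inj₂ e = e

=F-false⇒≢ : ∀ {N} {x y : Fin N} → (x =F y) ≡ false → x ≡ y → ⊥
=F-false⇒≢ {x = x} e refl = true≢false (≡⇒=F {x = x} refl) e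

any-true⁻ : ∀ {A : Set} {p : A → Bool} (xs : List A) → any p xs ≡ true → ∃ λ x → x ∈ xs × p x ≡ true
any-true⁻ [] ()
any-true⁻ {p = p} (x ∷ xs) e with true-or-false (p x)
... | inj₁ px = x , here refl , px
... | inj₂ px rewrite px = let (y , m , py) = any-true⁻ xs e in y , there m , py
any-true⁺ : ∀ {A : Set} {p : A → Bool} {xs : List A} {x} → x ∈ xs → p x ≡ true → any p xs ≡ true
any-true⁺ {p = p} (here refl) px rewrite px = refl
any-true⁺ {p = p} {y ∷ _} (there m) px = ∨-true⁺ʳ {p y} (any-true⁺ m px)
any-false⁺ : ∀ {A : Set} {p : A → Bool} (xs : List A) → (∀ x → x ∈ xs → p x ≡ false) → any p xs ≡ false
any-false⁺ [] f = refl
any-false⁺ (x ∷ xs) f rewrite f x (here refl) = any-false⁺ xs (λ y m → f y (there m))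
all-true⁻ : ∀ {A : Set} {p : A → Bool} {xs : List A} {x} → all p xs ≡ true → x ∈ xs → p x ≡ true
all-true⁻ {p = p} {y ∷ _} e (here refl) = ∧-true⁻ˡ {p y} e
all-true⁻ {p = p} {y ∷ _} e (there m) = all-true⁻ (∧-true⁻ʳ {p y} e) m
all-true⁺ : ∀ {A : Set} {p : A → Bool} (xs : List A) → (∀ x → x ∈ xs → p x ≡ true) → all p xs ≡ true
all-true⁺ [] f = refl
all-true⁺ (x ∷ xs) f rewrite f x (here refl) = all-true⁺ xs (λ y m → f y (there m))

countᵇ-mono : ∀ {A : Set} {p q : A → Bool} (xs : List A) → (∀ x → x ∈ xs → p x ≡ true → q x ≡ true) → countᵇ p xs ≤ countᵇ q xs
countᵇ-mono [] f = z≤n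
countᵇ-mono {p = p} {q} (x ∷ xs) f with true-or-false (p x) | true-or-false (q x)
... | inj₁ px | inj₁ qx rewrite px | qx = s≤s (countᵇ-mono xs (λ y m → f y (there m)))
... | inj₁ px | inj₂ qx = ⊥-elim (true≢false (f x (here refl) px) qx)
... | inj₂ px | inj₁ qx rewrite px | qx = m≤n⇒m≤1+n (countᵇ-mono xs (λ y m → f y (there m)))
... | inj₂ px | inj₂ qx rewrite px | qx = countᵇ-mono xs (λ y m → f y (there m))

countᵇ-pos⇒∃ : ∀ {A : Set} {p : A → Bool} (xs : List A) → 1 ≤ countᵇ p xs → ∃ λ x → x ∈ xs × p x ≡ true
countᵇ-pos⇒∃ [] ()
countᵇ-pos⇒∃ {p = p} (x ∷ xs) h with true-or-false (p x)
... | inj₁ px = x , here refl , px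
... | inj₂ px rewrite px = let (y , m , py) = countᵇ-pos⇒∃ xs h in y , there m , py

∈⇒countᵇ-pos : ∀ {A : Set} {p : A → Bool} {xs : List A} {x} → x ∈ xs → p x ≡ true → 1 ≤ countᵇ p xs
∈⇒countᵇ-pos {p = p} {y ∷ xs} (here refl) px rewrite px = s≤s z≤n
∈⇒countᵇ-pos {p = p} {y ∷ xs} (there m) px with p y
... | true = s≤s z≤n
... | false = ∈⇒countᵇ-pos m px

countᵇ-<⇒∃ : ∀ {A : Set} {p q : A → Bool} (xs : List A) → countᵇ q xs < countᵇ p xs → ∃ λ x → x ∈ xs × p x ≡ true × q x ≡ false
countᵇ-<⇒∃ [] ()
countᵇ-<⇒∃ {p = p} {q} (x ∷ xs) h with true-or-false (p x) | true-or-false (q x)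
... | inj₁ px | inj₂ qx = x , here refl , px , qx
... | inj₁ px | inj₁ qx rewrite px | qx = let (y , m , r) = countᵇ-<⇒∃ xs (≤-pred h) in y , there m , r
... | inj₂ px | inj₁ qx rewrite px | qx = let (y , m , r) = countᵇ-<⇒∃ xs (≤-trans (n≤1+n _) h) in y , there m , r
... | inj₂ px | inj₂ qx rewrite px | qx = let (y , m , r) = countᵇ-<⇒∃ xs h in y , there m , r

countᵇ-∨ : ∀ {A : Set} {p q r : A → Bool} (xs : List A) → (∀ x → p x ≡ true → (q x ∨ r x) ≡ true) → countᵇ p xs ≤ countᵇ q xs + countᵇ r xs
countᵇ-∨ [] f = z≤n
countᵇ-∨ {p = p} {q} {r} (x ∷ xs) f with true-or-false (p x) | true-or-false (q x) | true-or-false (r x)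
... | inj₁ px | inj₁ qx | inj₁ rx rewrite px | qx | rx = s≤s (≤-trans (countᵇ-∨ xs f) (+-monoʳ-≤ _ (n≤1+n _)))
... | inj₁ px | inj₁ qx | inj₂ rx rewrite px | qx | rx = s≤s (countᵇ-∨ xs f)
... | inj₁ px | inj₂ qx | inj₁ rx rewrite px | qx | rx = ≤-trans (s≤s (countᵇ-∨ xs f)) (≤-reflexive (sym (+-suc _ _)))
... | inj₁ px | inj₂ qx | inj₂ rx = ⊥-elim (true≢false (f x px) (trans (cong₂ _∨_ qx rx) refl))
... | inj₂ px | inj₁ qx | inj₁ rx rewrite px | qx | rx = m≤n⇒m≤1+n (≤-trans (countᵇ-∨ xs f) (+-monoʳ-≤ _ (n≤1+n _)))
... | inj₂ px | inj₁ qx | inj₂ rx rewrite px | qx | rx = m≤n⇒m≤1+n (countᵇ-∨ xs f)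
... | inj₂ px | inj₂ qx | inj₁ rx rewrite px | qx | rx = ≤-trans (countᵇ-∨ xs f) (≤-trans (n≤1+n _) (≤-reflexive (sym (+-suc _ _))))
... | inj₂ px | inj₂ qx | inj₂ rx rewrite px | qx | rx = countᵇ-∨ xs f

countᵇ-remove : ∀ {N} {p : Fin N → Bool} (xs : List (Fin N)) {w} → w ∈ xs → p w ≡ true →
               suc (countᵇ (λ v → p v ∧ not (v =F w)) xs) ≤ countᵇ p xs
countᵇ-remove {p = p} (x ∷ xs) {w} (here refl) pw rewrite pw | ≡⇒=F {x = x} refl =
  s≤s (countᵇ-mono xs (λ y _ e → ∧-true⁻ˡ {p y} e))
countᵇ-remove {p = p} (x ∷ xs) {w} (there m) pw with true-or-false (p x)
... | inj₂ px rewrite px = countᵇ-remove xs m pw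
... | inj₁ px rewrite px with true-or-false (x =F w)
... | inj₁ e rewrite e = ≤-trans (countᵇ-remove xs m pw) (n≤1+n _)
... | inj₂ e rewrite e = s≤s (countᵇ-remove xs m pw)

countᵇ-map : ∀ {A B : Set} {p : B → Bool} (f : A → B) (xs : List A) → countᵇ p (map f xs) ≡ countᵇ (λ x → p (f x)) xs
countᵇ-map f [] = refl
countᵇ-map {p = p} f (x ∷ xs) with p (f x)
... | true = cong suc (countᵇ-map f xs)
... | false = countᵇ-map f xs

countᵇ-false : ∀ {A : Set} (xs : List A) → countᵇ (λ _ → false) xs ≡ 0
countᵇ-false [] = refl
countᵇ-false (_ ∷ xs) = countᵇ-false xs

countᵇ-tabulate-suc : ∀ {N} (p : Fin (suc N) → Bool) → countᵇ p (tabulate fs) ≡ countᵇ (p ∘ fs) (allFin N)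
countᵇ-tabulate-suc {N} p = trans (cong (countᵇ p) (sym (LP.map-tabulate id fs))) (countᵇ-map {p = p} fs (allFin N))

countᵇ-=F : ∀ {N} (w : Fin N) → countᵇ (_=F w) (allFin N) ≡ 1
countᵇ-=F {suc N} fz = cong suc (trans (countᵇ-tabulate-suc {N} (_=F fz)) (countᵇ-false (allFin N)))
countᵇ-=F {suc N} (fs w) = trans (countᵇ-tabulate-suc {N} (_=F fs w)) (countᵇ-=F w)

countᵇ-≤-suc-remove : ∀ {N} (p : Fin N → Bool) (w : Fin N) → countᵇ p (allFin N) ≤ suc (countᵇ (λ v → p v ∧ not (v =F w)) (allFin N))
countᵇ-≤-suc-remove {N} p w = begin
  countᵇ p (allFin N)                                    ≤⟨ countᵇ-∨ {q = p-w} {r = _=F w} (allFin N) split ⟩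
  countᵇ p-w (allFin N) + countᵇ (_=F w) (allFin N)      ≡⟨ cong (countᵇ p-w (allFin N) +_) (countᵇ-=F w) ⟩
  countᵇ p-w (allFin N) + 1                              ≡⟨ +-comm _ 1 ⟩
  suc (countᵇ p-w (allFin N))                            ∎
  where
  open ≤-Reasoning
  p-w : Fin N → Bool
  p-w v = p v ∧ not (v =F w)
  split : ∀ x → p x ≡ true → (p-w x ∨ (x =F w)) ≡ true
  split x px rewrite px with x =F w
  ... | true = refl
  ... | false = refl

countᵇ-≤1 : ∀ {N} (p : Fin N → Bool) (w : Fin N) → (∀ v → p v ≡ true → v ≡ w) → countᵇ p (allFin N) ≤ 1
countᵇ-≤1 p w f = ≤-trans (countᵇ-mono (allFin _) (λ v _ e → ≡⇒=F (f v e))) (≤-reflexive (countᵇ-=F w))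

countᵇ-mono-< : ∀ {A : Set} {p q : A → Bool} (xs : List A) → (∀ x → x ∈ xs → p x ≡ true → q x ≡ true) →
               ∀ {z} → z ∈ xs → p z ≡ false → q z ≡ true → countᵇ p xs < countᵇ q xs
countᵇ-mono-< {p = p} {q} (x ∷ xs) f (here refl) pz qz rewrite pz | qz = s≤s (countᵇ-mono xs (λ y m → f y (there m)))
countᵇ-mono-< {p = p} {q} (x ∷ xs) f (there mz) pz qz with true-or-false (p x) | true-or-false (q x)
... | inj₁ px | inj₁ qx rewrite px | qx = s≤s (countᵇ-mono-< xs (λ y m → f y (there m)) mz pz qz)
... | inj₁ px | inj₂ qx = ⊥-elim (true≢false (f x (here refl) px) qx)
... | inj₂ px | inj₁ qx rewrite px | qx = m≤n⇒m≤1+n (countᵇ-mono-< xs (λ y m → f y (there m)) mz pz qz)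
... | inj₂ px | inj₂ qx rewrite px | qx = countᵇ-mono-< xs (λ y m → f y (there m)) mz pz qz

argmax : ∀ {A : Set} (f : A → ℕ) (P : A → Bool) (xs : List A) {x0} → x0 ∈ xs → P x0 ≡ true →
         ∃ λ x → x ∈ xs × P x ≡ true × (∀ y → y ∈ xs → P y ≡ true → f y ≤ f x)
argmax f P (x ∷ xs) {x0} m px0 with true-or-false (P x) | true-or-false (any P xs)
... | inj₂ px | _ with m
... | here refl = ⊥-elim (true≢false px0 px)
... | there m' = let (r , mr , pr , best) = argmax f P xs m' px0 in
      r , there mr , pr , λ { y (here refl) py → ⊥-elim (true≢false py px) ; y (there my) py → best y my py }
argmax f P (x ∷ xs) {x0} m px0 | inj₁ px | inj₂ ar =
      x , here refl , px , λ { y (here refl) py → ≤-refl ; y (there my) py → ⊥-elim (true≢false (any-true⁺ my py) ar) }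
argmax f P (x ∷ xs) {x0} m px0 | inj₁ px | inj₁ ar with any-true⁻ xs ar
... | x1 , m1 , p1 with argmax f P xs m1 p1
... | r , mr , pr , best with f x ≤? f r
...   | yes le = r , there mr , pr , λ { y (here refl) py → le ; y (there my) py → best y my py }
...   | no nle = x , here refl , px , λ { y (here refl) py → ≤-refl ; y (there my) py → ≤-trans (best y my py) (<⇒≤ (≰⇒> nle)) }

elemF⇒∈ : ∀ {N} {v : Fin N} (xs : List (Fin N)) → elemF v xs ≡ true → v ∈ xs
elemF⇒∈ xs e = let (y , m , q) = any-true⁻ xs e in subst (_∈ xs) (sym (=F⇒≡ q)) m
∈⇒elemF : ∀ {N} {v : Fin N} {xs : List (Fin N)} → v ∈ xs → elemF v xs ≡ true
∈⇒elemF {v = v} m = any-true⁺ m (≡⇒=F {x = v} refl)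
∉⇒elemF-false : ∀ {N} {v : Fin N} (xs : List (Fin N)) → (v ∈ xs → ⊥) → elemF v xs ≡ false
∉⇒elemF-false {v = v} xs ne with true-or-false (elemF v xs)
... | inj₁ e = ⊥-elim (ne (elemF⇒∈ xs e))
... | inj₂ e = e

∈-allLists : ∀ {A : Set} (xs : List A) (L : ℕ) (l : List A) → length l ≤ L → (∀ v → v ∈ l → v ∈ xs) → l ∈ allLists xs L
∈-allLists xs zero [] _ _ = here refl
∈-allLists xs (suc L) [] _ _ = here refl
∈-allLists xs (suc L) (v ∷ l) (s≤s h) f =
  there (∈-concatMap⁺ (λ x → map (x ∷_) (allLists xs L)) (lose (f v (here refl)) (∈-map⁺ (v ∷_) (∈-allLists xs L l h (λ w m → f w (there m))))))

module Paths {m : ℕ} (G : LGraph m) where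
  V : Set
  V = Fin (n G)

  distinct-length≤countᵇ : (ys : List V) → distinct G ys ≡ true → (zs : List V) → (∀ v → v ∈ ys → v ∈ zs) →
               length ys ≤ countᵇ (λ v → elemF v ys) zs
  distinct-length≤countᵇ [] _ zs _ = z≤n
  distinct-length≤countᵇ (y ∷ ys) d zs f =
    ≤-trans (s≤s (≤-trans (distinct-length≤countᵇ ys (∧-true⁻ʳ {not (elemF y ys)} d) zs (λ v mm → f v (there mm)))
                          (countᵇ-mono zs gg)))
            (countᵇ-remove {p = λ v → elemF v (y ∷ ys)} zs (f y (here refl)) (∈⇒elemF {v = y} {xs = y ∷ ys} (here refl)))
    where
    gg : ∀ v → v ∈ zs → elemF v ys ≡ true → (elemF v (y ∷ ys) ∧ not (v =F y)) ≡ true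
    gg v _ e with true-or-false (v =F y)
    ... | inj₁ q = ⊥-elim (true≢false (subst (λ w → elemF w ys ≡ true) (=F⇒≡ {x = v} {y = y} q) e) (not-true⁻ (∧-true⁻ˡ {not (elemF y ys)} d)))
    ... | inj₂ q rewrite q = ∧-true⁺ e refl

  distinct-length≤ : (ys : List V) → distinct G ys ≡ true → length ys ≤ n G
  distinct-length≤ ys d = ≤-trans (distinct-length≤countᵇ ys d (allFin (n G)) (λ v _ → ∈-allFin v))
                   (≤-trans (LP.length-filter (T? ∘ (λ v → elemF v ys)) (allFin (n G))) (≤-reflexive (LP.length-tabulate id)))

  distinct∈candidates : (ys : List V) → distinct G ys ≡ true → ys ∈ candidates G
  distinct∈candidates ys d = ∈-allLists (vertices G) (n G) ys (distinct-length≤ ys d) (λ v _ → ∈-allFin v)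

  lastOf : V → List V → V
  lastOf x [] = x
  lastOf x (y ∷ ys) = lastOf y ys

  lastIs-≡ : ∀ t x xs → lastIs G t x xs ≡ (lastOf x xs =F t)
  lastIs-≡ t x [] = refl
  lastIs-≡ t x (y ∷ ys) = lastIs-≡ t y ys

  lastOf-++ : ∀ h pre x post → lastOf h (pre ++ x ∷ post) ≡ lastOf x post
  lastOf-++ h [] x post = refl
  lastOf-++ h (y ∷ pre) x post = lastOf-++ y pre x post

  chain-suffix : ∀ pre x post → chain G (pre ++ x ∷ post) ≡ true → chain G (x ∷ post) ≡ true
  chain-suffix [] x post c = c
  chain-suffix (y ∷ []) x post c = ∧-true⁻ʳ {adj G y x} c
  chain-suffix (y ∷ z ∷ pre) x post c = chain-suffix (z ∷ pre) x post (∧-true⁻ʳ {adj G y z} c)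

  distinct-suffix : ∀ pre x post → distinct G (pre ++ x ∷ post) ≡ true → distinct G (x ∷ post) ≡ true
  distinct-suffix [] x post d = d
  distinct-suffix (y ∷ pre) x post d = distinct-suffix pre x post (∧-true⁻ʳ {not (elemF y (pre ++ x ∷ post))} d)

  data Walk : V → V → Set where
    wend : (v : V) → Walk v v
    wstep : ∀ {x y t} → adj G x y ≡ true → Walk y t → Walk x t

  verts : ∀ {s t} → Walk s t → List V
  verts (wend v) = v ∷ []
  verts (wstep {x} _ w) = x ∷ verts w

  _++w_ : ∀ {s t r} → Walk s t → Walk t r → Walk s r
  wend _ ++w w' = w'
  wstep a w ++w w' = wstep a (w ++w w')

  ∈-++w : ∀ {s t r} (w : Walk s t) (w' : Walk t r) {v} → v ∈ verts (w ++w w') → v ∈ verts w ⊎ v ∈ verts w'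
  ∈-++w (wend _) w' m = inj₂ m
  ∈-++w (wstep _ w) w' (here p) = inj₁ (here p)
  ∈-++w (wstep _ w) w' (there m) with ∈-++w w w' m
  ... | inj₁ m' = inj₁ (there m')
  ... | inj₂ m' = inj₂ m'

  wsnoc : ∀ {s t r} → Walk s t → adj G t r ≡ true → Walk s r
  wsnoc (wend v) a = wstep a (wend _)
  wsnoc (wstep a' w) a = wstep a' (wsnoc w a)

  ∈-wsnoc : ∀ {s t r} (w : Walk s t) (a : adj G t r ≡ true) {v} → v ∈ verts (wsnoc w a) → v ∈ verts w ⊎ v ≡ r
  ∈-wsnoc (wend _) a (here p) = inj₁ (here p)
  ∈-wsnoc (wend _) a (there (here p)) = inj₂ p
  ∈-wsnoc (wstep _ w) a (here p) = inj₁ (here p)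
  ∈-wsnoc (wstep _ w) a (there m) with ∈-wsnoc w a m
  ... | inj₁ m' = inj₁ (there m')
  ... | inj₂ e = inj₂ e

  head∈ : ∀ {s t} (w : Walk s t) → s ∈ verts w
  head∈ (wend _) = here refl
  head∈ (wstep _ _) = here refl

  last∈ : ∀ {s t} (w : Walk s t) → t ∈ verts w
  last∈ (wend _) = here refl
  last∈ (wstep _ w) = there (last∈ w)

  module Reverse (sym-adj : ∀ x y → adj G x y ≡ adj G y x) where
    wrev : ∀ {s t} → Walk s t → Walk t s
    wrev (wend v) = wend v
    wrev (wstep {x} {y} a w) = wsnoc (wrev w) (trans (sym-adj y x) a)

    ∈-wrev : ∀ {s t} (w : Walk s t) {v} → v ∈ verts (wrev w) → v ∈ verts w
    ∈-wrev (wend _) m = m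
    ∈-wrev (wstep {x} {y} a w) m with ∈-wsnoc (wrev w) (trans (sym-adj y x) a) m
    ... | inj₁ m' = there (∈-wrev w m')
    ... | inj₂ refl = here refl

  chain⇒walk : ∀ x xs → chain G (x ∷ xs) ≡ true → Σ (Walk x (lastOf x xs)) (λ w → verts w ≡ x ∷ xs)
  chain⇒walk x [] c = wend x , refl
  chain⇒walk x (y ∷ ys) c = let (w , e) = chain⇒walk y ys (∧-true⁻ʳ {adj G x y} c) in
    wstep (∧-true⁻ˡ {adj G x y} c) w , cong (x ∷_) e

  lastOf-∈ : ∀ x xs → lastOf x xs ∈ x ∷ xs
  lastOf-∈ x [] = here refl
  lastOf-∈ x (y ∷ ys) = there (lastOf-∈ y ys)

  lastOf-eq : ∀ y ys pre x post → y ∷ ys ≡ pre ++ x ∷ post → lastOf y ys ≡ lastOf x post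
  lastOf-eq y ys [] x post refl = refl
  lastOf-eq y ys (z ∷ pre) x post refl = lastOf-++ y pre x post

  shorten-walk : ∀ {s t} (w : Walk s t) → Σ (List V) λ ys → chain G (s ∷ ys) ≡ true × distinct G (s ∷ ys) ≡ true ×
            lastOf s ys ≡ t × (∀ v → v ∈ s ∷ ys → v ∈ verts w)
  shorten-walk (wend v) = [] , refl , refl , refl , (λ v m → m)
  shorten-walk (wstep {x} {y} a w) with shorten-walk w
  ... | ys , ch , d , l , sub with true-or-false (elemF x (y ∷ ys))
  ... | inj₁ e = let (pre , post , eq) = ∈-∃++ (elemF⇒∈ (y ∷ ys) e) in
          post ,
          chain-suffix pre x post (subst (λ z → chain G z ≡ true) eq ch) ,
          distinct-suffix pre x post (subst (λ z → distinct G z ≡ true) eq d) ,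
          trans (sym (lastOf-eq y ys pre x post eq)) l ,
          (λ v m → there (sub v (subst (v ∈_) (sym eq) (∈-++⁺ʳ pre m))))
  ... | inj₂ e = y ∷ ys , ∧-true⁺ a ch , ∧-true⁺ (not-true⁺ e) d , l ,
          (λ { v (here p) → here p ; v (there m) → there (sub v m) })

  isPath⁻ : ∀ {s t} l → isPath G s t l ≡ true → Σ (List V) λ ys → l ≡ s ∷ ys × chain G (s ∷ ys) ≡ true ×
           distinct G (s ∷ ys) ≡ true × lastOf s ys ≡ t
  isPath⁻ {s} {t} (x ∷ xs) p with =F⇒≡ {x = x} {y = s} (∧-true⁻ˡ {x =F s} p)
  ... | refl = xs , refl , ∧-true⁻ˡ {chain G (x ∷ xs)} r2 , ∧-true⁻ʳ {chain G (x ∷ xs)} r2 ,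
               =F⇒≡ {x = lastOf x xs} {y = t} (trans (sym (lastIs-≡ t x xs)) (∧-true⁻ˡ {lastIs G t x xs} r1))
    where
    r1 = ∧-true⁻ʳ {x =F x} p
    r2 = ∧-true⁻ʳ {lastIs G t x xs} r1

  isPath⁺ : ∀ {s t} ys → chain G (s ∷ ys) ≡ true → distinct G (s ∷ ys) ≡ true → lastOf s ys ≡ t →
           isPath G s t (s ∷ ys) ≡ true
  isPath⁺ {s} {t} ys c d l = ∧-true⁺ (≡⇒=F {x = s} refl) (∧-true⁺ (trans (lastIs-≡ t s ys) (≡⇒=F {x = lastOf s ys} l)) (∧-true⁺ c d))

  walk⇒path : ∀ {s t} (w : Walk s t) → Σ (List V) λ l → isPath G s t l ≡ true × (∀ v → v ∈ l → v ∈ verts w)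
  walk⇒path w = let (ys , c , d , l , sub) = shorten-walk w in _ ∷ ys , isPath⁺ ys c d l , sub

  path⇒walk : ∀ {s t} l → isPath G s t l ≡ true → Σ (Walk s t) λ w → verts w ≡ l
  path⇒walk {s} {t} l p with isPath⁻ l p
  ... | ys , refl , c , d , refl = chain⇒walk s ys c

  isPath⇒distinct : ∀ {s t} l → isPath G s t l ≡ true → distinct G l ≡ true
  isPath⇒distinct l p with isPath⁻ l p
  ... | ys , refl , c , d , _ = d

  isPath⇒chain : ∀ {s t} l → isPath G s t l ≡ true → chain G l ≡ true
  isPath⇒chain l p with isPath⁻ l p
  ... | ys , refl , c , d , _ = c

  reachAvoiding⁺ : ∀ {u a x} (w : Walk a x) → (u ∈ verts w → ⊥) → reachAvoiding G u a x ≡ true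
  reachAvoiding⁺ {u} {a} {x} w nu with walk⇒path w
  ... | l , p , sub = any-true⁺ (distinct∈candidates l (isPath⇒distinct l p)) (∧-true⁺ p (not-true⁺ (∉⇒elemF-false l (λ m → nu (sub u m)))))

  reachAvoiding⁻ : ∀ {u a x} → reachAvoiding G u a x ≡ true → Σ (Walk a x) λ w → u ∈ verts w → ⊥
  reachAvoiding⁻ {u} {a} {x} r with any-true⁻ (candidates G) r
  ... | l , _ , q with path⇒walk l (∧-true⁻ˡ {isPath G a x l} q)
  ... | w , refl = w , λ m → true≢false (∈⇒elemF m) (not-true⁻ (∧-true⁻ʳ {isPath G a x (verts w)} q))

  onPath⁺ : ∀ {v s t} l → isPath G s t l ≡ true → v ∈ l → onPath G v s t ≡ true
  onPath⁺ l p m = any-true⁺ (distinct∈candidates l (isPath⇒distinct l p)) (∧-true⁺ p (∈⇒elemF m))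

  onPath⁻ : ∀ {v s t} → onPath G v s t ≡ true → Σ (List V) λ l → isPath G s t l ≡ true × v ∈ l
  onPath⁻ {v} {s} {t} o with any-true⁻ (candidates G) o
  ... | l , _ , q = l , ∧-true⁻ˡ {isPath G s t l} q , elemF⇒∈ l (∧-true⁻ʳ {isPath G s t l} q)

  chain-prefix : ∀ xs ys → chain G (xs ++ ys) ≡ true → chain G xs ≡ true
  chain-prefix [] ys c = refl
  chain-prefix (x ∷ []) ys c = refl
  chain-prefix (x ∷ y ∷ xs) ys c = ∧-true⁺ (∧-true⁻ˡ {adj G x y} c) (chain-prefix (y ∷ xs) ys (∧-true⁻ʳ {adj G x y} c))

  distinct-prefix : ∀ xs ys → distinct G (xs ++ ys) ≡ true → distinct G xs ≡ true
  distinct-prefix [] ys d = refl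
  distinct-prefix (x ∷ xs) ys d = ∧-true⁺ (not-true⁺ (∉⇒elemF-false {v = x} xs (λ m → true≢false (∈⇒elemF (∈-++⁺ˡ {ys = ys} m)) (not-true⁻ (∧-true⁻ˡ {not (elemF x (xs ++ ys))} d)))))
                               (distinct-prefix xs ys (∧-true⁻ʳ {not (elemF x (xs ++ ys))} d))

  distinct-++-disjoint : ∀ xs ys {x} → distinct G (xs ++ ys) ≡ true → x ∈ xs → x ∈ ys → ⊥
  distinct-++-disjoint (z ∷ xs) ys d (here refl) m2 = true≢false (∈⇒elemF (∈-++⁺ʳ xs m2)) (not-true⁻ (∧-true⁻ˡ {not (elemF z (xs ++ ys))} d))
  distinct-++-disjoint (z ∷ xs) ys d (there m1) m2 = distinct-++-disjoint xs ys (∧-true⁻ʳ {not (elemF z (xs ++ ys))} d) m1 m2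

  distinct-tail : ∀ x xs → distinct G (x ∷ xs) ≡ true → distinct G xs ≡ true
  distinct-tail x xs d = ∧-true⁻ʳ {not (elemF x xs)} d

  distinct-head : ∀ x xs → distinct G (x ∷ xs) ≡ true → x ∈ xs → ⊥
  distinct-head x xs d m = true≢false (∈⇒elemF m) (not-true⁻ (∧-true⁻ˡ {not (elemF x xs)} d))

  chain-tail : ∀ x xs → chain G (x ∷ xs) ≡ true → chain G xs ≡ true
  chain-tail x [] c = refl
  chain-tail x (y ∷ xs) c = ∧-true⁻ʳ {adj G x y} c

  distinct-∷ : ∀ x xs → (x ∈ xs → ⊥) → distinct G xs ≡ true → distinct G (x ∷ xs) ≡ true
  distinct-∷ x xs nm d = ∧-true⁺ (not-true⁺ (∉⇒elemF-false {v = x} xs nm)) d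

  chain-++ : ∀ x xs y ys → chain G (x ∷ xs) ≡ true → chain G (y ∷ ys) ≡ true → adj G (lastOf x xs) y ≡ true →
              chain G (x ∷ xs ++ y ∷ ys) ≡ true
  chain-++ x [] y ys c1 c2 a = ∧-true⁺ a c2
  chain-++ x (x2 ∷ xs) y ys c1 c2 a = ∧-true⁺ (∧-true⁻ˡ {adj G x x2} c1) (chain-++ x2 xs y ys (∧-true⁻ʳ {adj G x x2} c1) c2 a)

  distinct-++ : ∀ xs ys → distinct G xs ≡ true → distinct G ys ≡ true → (∀ {x} → x ∈ xs → x ∈ ys → ⊥) → distinct G (xs ++ ys) ≡ true
  distinct-++ [] ys d1 d2 f = d2
  distinct-++ (x ∷ xs) ys d1 d2 f = distinct-∷ x (xs ++ ys) nm (distinct-++ xs ys (distinct-tail x xs d1) d2 (λ m1 m2 → f (there m1) m2))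
    where
    nm : x ∈ xs ++ ys → ⊥
    nm m with ∈-++⁻ xs m
    ... | inj₁ m1 = distinct-head x xs d1 m1
    ... | inj₂ m2 = f (here refl) m2

  prefix-isPath : ∀ h hs L1 x L2 → h ∷ hs ≡ L1 ++ x ∷ L2 → chain G (h ∷ hs) ≡ true → distinct G (h ∷ hs) ≡ true →
               isPath G h x (L1 ++ x ∷ []) ≡ true
  prefix-isPath h hs [] x L2 refl c d = isPath⁺ {s = h} [] refl refl refl
  prefix-isPath h hs (h' ∷ L1) x L2 refl c d =
    isPath⁺ (L1 ++ x ∷ []) (chain-prefix (h ∷ L1 ++ x ∷ []) L2 (subst (λ X → chain G X ≡ true) eq c))
           (distinct-prefix (h ∷ L1 ++ x ∷ []) L2 (subst (λ X → distinct G X ≡ true) eq d)) (lastOf-++ h L1 x [])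
    where
    eq : h ∷ L1 ++ x ∷ L2 ≡ (h ∷ L1 ++ x ∷ []) ++ L2
    eq = cong (h ∷_) (sym (LP.++-assoc L1 (x ∷ []) L2))

  suffix-isPath : ∀ h hs L1 x L2 → h ∷ hs ≡ L1 ++ x ∷ L2 → chain G (h ∷ hs) ≡ true → distinct G (h ∷ hs) ≡ true →
               isPath G x (lastOf h hs) (x ∷ L2) ≡ true
  suffix-isPath h hs L1 x L2 eq c d =
    isPath⁺ L2 (chain-suffix L1 x L2 (subst (λ X → chain G X ≡ true) eq c)) (distinct-suffix L1 x L2 (subst (λ X → distinct G X ≡ true) eq d))
           (sym (lastOf-eq h hs L1 x L2 eq))

  chain-snoc : ∀ x ys z → chain G (x ∷ ys) ≡ true → adj G (lastOf x ys) z ≡ true → chain G (x ∷ ys ++ z ∷ []) ≡ true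
  chain-snoc x [] z c a = ∧-true⁺ a refl
  chain-snoc x (y ∷ ys) z c a = ∧-true⁺ (∧-true⁻ˡ {adj G x y} c) (chain-snoc y ys z (∧-true⁻ʳ {adj G x y} c) a)

  distinct-snoc : ∀ ys z → distinct G ys ≡ true → (z ∈ ys → ⊥) → distinct G (ys ++ z ∷ []) ≡ true
  distinct-snoc [] z d nz = refl
  distinct-snoc (y ∷ ys) z d nz = ∧-true⁺ (not-true⁺ (∉⇒elemF-false (ys ++ z ∷ []) f)) (distinct-snoc ys z (∧-true⁻ʳ {not (elemF y ys)} d) (λ m → nz (there m)))
    where
    f : y ∈ ys ++ z ∷ [] → ⊥
    f m with ∈-++⁻ ys m
    ... | inj₁ m' = true≢false (∈⇒elemF m') (not-true⁻ (∧-true⁻ˡ {not (elemF y ys)} d))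
    ... | inj₂ (here refl) = nz (here refl)

  lastOf-snoc : ∀ x ys z → lastOf x (ys ++ z ∷ []) ≡ z
  lastOf-snoc x [] z = refl
  lastOf-snoc x (y ∷ ys) z = lastOf-snoc y ys z

  length-snoc-pos : ∀ {A : Set} (ys : List A) {z : A} → 1 ≤ length (ys ++ z ∷ [])
  length-snoc-pos [] = s≤s z≤n
  length-snoc-pos (_ ∷ ys) = s≤s z≤n

  walk-prefix : ∀ {s t v} (w : Walk s t) → v ∈ verts w → Σ (Walk s v) λ w' → ∀ y → y ∈ verts w' → y ∈ verts w
  walk-prefix (wend _) (here refl) = wend _ , λ y m → m
  walk-prefix (wstep a w) (here refl) = wend _ , λ { y (here refl) → here refl }
  walk-prefix (wstep a w) (there m) = let (w' , f) = walk-prefix w m in wstep a w' ,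
    λ { y (here p) → here p ; y (there m') → there (f y m') }

  walk-suffix : ∀ {s t v} (w : Walk s t) → v ∈ verts w → Σ (Walk v t) λ w' → ∀ y → y ∈ verts w' → y ∈ verts w
  walk-suffix (wend _) (here refl) = wend _ , λ y m → m
  walk-suffix (wstep a w) (here refl) = wstep a w , λ y m → m
  walk-suffix (wstep a w) (there m) = let (w' , f) = walk-suffix w m in w' , λ y m' → there (f y m')

  reachAvoiding-along-walk : ∀ {u a t v} (w : Walk a t) → (u ∈ verts w → ⊥) → v ∈ verts w → reachAvoiding G u a v ≡ true
  reachAvoiding-along-walk w nu m = let (w' , f) = walk-prefix w m in reachAvoiding⁺ w' (λ m' → nu (f _ m'))

  reachAvoiding⇒≢ : ∀ {u a x} → reachAvoiding G u a x ≡ true → (u ≡ x → ⊥)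
  reachAvoiding⇒≢ r refl = let (w , nu) = reachAvoiding⁻ r in nu (last∈ w)

module Degrees {m : ℕ} (G : LGraph m) where

  degree1-neighbour-unique : ∀ {v x y} → degree G v ≡ 1 → adj G v x ≡ true → adj G v y ≡ true → x ≡ y
  degree1-neighbour-unique {v} {x} {y} d ax ay with x ≟ y
  ... | yes e = e
  ... | no ne = ⊥-elim (1+n≰n (≤-trans (s≤s (≤-trans (∈⇒countᵇ-pos {p = λ w → adj G v w ∧ not (w =F x)} (∈-allFin y) (∧-true⁺ ay (not-true⁺ (≢⇒=F-false (λ e → ne (sym e))))))
                  (≤-reflexive refl))) (≤-trans (countᵇ-remove {p = adj G v} (allFin _) (∈-allFin x) ax) (≤-reflexive d))))

  degree3-other-neighbour : ∀ {v x} → degree G v ≡ 3 → ∃ λ y → adj G v y ≡ true × (y ≡ x → ⊥)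
  degree3-other-neighbour {v} {x} d with countᵇ-pos⇒∃ {p = λ w → adj G v w ∧ not (w =F x)} (allFin _)
        (≤-trans (s≤s z≤n) (≤-pred (≤-trans (≤-reflexive (sym d)) (countᵇ-≤-suc-remove (adj G v) x))))
  ... | y , _ , q = y , ∧-true⁻ˡ {adj G v y} q , λ e → true≢false (≡⇒=F {x = y} {y = x} e) (not-true⁻ (∧-true⁻ʳ {adj G v y} q))

  degree3-third-neighbour : ∀ {v x y} → degree G v ≡ 3 → ∃ λ z → adj G v z ≡ true × (z ≡ x → ⊥) × (z ≡ y → ⊥)
  degree3-third-neighbour {v} {x} {y} d with countᵇ-pos⇒∃ {p = λ w → (adj G v w ∧ not (w =F x)) ∧ not (w =F y)} (allFin _)
        (≤-pred (≤-pred (≤-trans (≤-reflexive (sym d)) (≤-trans (countᵇ-≤-suc-remove (adj G v) x) (s≤s (countᵇ-≤-suc-remove (λ w → adj G v w ∧ not (w =F x)) y))))))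
  ... | z , _ , q = z , ∧-true⁻ˡ {adj G v z} (∧-true⁻ˡ {adj G v z ∧ not (z =F x)} q) ,
                    (λ e → true≢false (≡⇒=F {x = z} {y = x} e) (not-true⁻ (∧-true⁻ʳ {adj G v z} (∧-true⁻ˡ {adj G v z ∧ not (z =F x)} q)))) ,
                    (λ e → true≢false (≡⇒=F {x = z} {y = y} e) (not-true⁻ (∧-true⁻ʳ {adj G v z ∧ not (z =F x)} q)))

  degree3-neighbours : ∀ {v a b c w} → degree G v ≡ 3 → adj G v a ≡ true → adj G v b ≡ true → adj G v c ≡ true →
               (a ≡ b → ⊥) → (a ≡ c → ⊥) → (b ≡ c → ⊥) → adj G v w ≡ true → w ≡ a ⊎ w ≡ b ⊎ w ≡ c
  degree3-neighbours {v} {a} {b} {c} {w} d va vb vc ab ac bc vw with w ≟ a | w ≟ b | w ≟ c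
  ... | yes e | _ | _ = inj₁ e
  ... | no _ | yes e | _ = inj₂ (inj₁ e)
  ... | no _ | no _ | yes e = inj₂ (inj₂ e)
  ... | no wa | no wb | no wc = ⊥-elim (1+n≰n (≤-trans step (≤-reflexive d)))
    where
    ne : ∀ {x y : Fin (n G)} → (x ≡ y → ⊥) → not (x =F y) ≡ true
    ne {x} {y} f = not-true⁺ (≢⇒=F-false f)
    p1 = λ z → adj G v z ∧ not (z =F a)
    p2 = λ z → p1 z ∧ not (z =F b)
    p3 = λ z → p2 z ∧ not (z =F c)
    step : 4 ≤ degree G v
    step = ≤-trans (s≤s (≤-trans (s≤s (≤-trans (s≤s
             (∈⇒countᵇ-pos {p = λ z → p3 z} (∈-allFin w) (∧-true⁺ (∧-true⁺ (∧-true⁺ vw (ne wa)) (ne wb)) (ne wc))))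
             (≤-trans (≤-reflexive refl) (countᵇ-remove {p = p2} (allFin _) (∈-allFin c) (∧-true⁺ (∧-true⁺ vc (ne (λ e → ac (sym e)))) (ne (λ e → bc (sym e))))))))
             (countᵇ-remove {p = p1} (allFin _) (∈-allFin b) (∧-true⁺ vb (ne (λ e → ab (sym e)))))))
             (countᵇ-remove {p = adj G v} (allFin _) (∈-allFin a) va)

  degree1≢degree3 : ∀ {v w} → degree G v ≡ 1 → degree G w ≡ 3 → v ≡ w → ⊥
  degree1≢degree3 d1 d3 refl with trans (sym d1) d3
  ... | ()

module Cherries {m : ℕ} where

  record CommonNeighbour (G : LGraph m) (x y : Fin m) : Set where
    constructor common-neighbour
    field
      centre : Fin (n G)
      adj-x  : adj G centre (leaf G x) ≡ true
      adj-y  : adj G centre (leaf G y) ≡ true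

  isCherry : LGraph m → Fin m → Fin m → Bool
  isCherry G x y = (toℕ x <ᵇ toℕ y) ∧ any (λ w → adj G w (leaf G x) ∧ adj G w (leaf G y)) (vertices G)

  isCherry⁻ : ∀ G {x y} → isCherry G x y ≡ true → toℕ x < toℕ y × CommonNeighbour G x y
  isCherry⁻ G {x} {y} h with any-true⁻ {p = λ w → adj G w (leaf G x) ∧ adj G w (leaf G y)} (vertices G) (∧-true⁻ʳ {toℕ x <ᵇ toℕ y} h)
  ... | w , _ , e = <ᵇ⇒< (toℕ x) (toℕ y) (Equivalence.from T-≡ (∧-true⁻ˡ {toℕ x <ᵇ toℕ y} h)) ,
                    common-neighbour w (∧-true⁻ˡ {adj G w (leaf G x)} e) (∧-true⁻ʳ {adj G w (leaf G x)} e)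

  isCherry⁺ : ∀ G {x y} → toℕ x < toℕ y → CommonNeighbour G x y → isCherry G x y ≡ true
  isCherry⁺ G lt (common-neighbour w wx wy) = ∧-true⁺ (Equivalence.to T-≡ (<⇒<ᵇ lt)) (any-true⁺ (∈-allFin w) (∧-true⁺ wx wy))

  isCherry-false : ∀ G {x y} → ¬ CommonNeighbour G x y → isCherry G x y ≡ false
  isCherry-false G {x} {y} ¬cn with true-or-false (isCherry G x y)
  ... | inj₁ h = ⊥-elim (¬cn (proj₂ (isCherry⁻ G h)))
  ... | inj₂ h = h

  pairs : List (Fin m × Fin m)
  pairs = concatMap (λ x → map (x ,_) (allFin m)) (allFin m)

  ∈-pairs : ∀ x y → (x , y) ∈ pairs
  ∈-pairs x y = ∈-concatMap⁺ (λ x → map (x ,_) (allFin m)) (lose (∈-allFin x) (∈-map⁺ (x ,_) (∈-allFin y)))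

  common-neighbour-sym : ∀ {G x y} → CommonNeighbour G x y → CommonNeighbour G y x
  common-neighbour-sym (common-neighbour w wx wy) = common-neighbour w wy wx

  CommonNeighbourMono : LGraph m → LGraph m → Set
  CommonNeighbourMono G H = ∀ x y → (x ≡ y → ⊥) → CommonNeighbour G x y → CommonNeighbour H x y

  cherries-<-ordered : ∀ {G H} → CommonNeighbourMono G H →
                       ∀ x y → toℕ x < toℕ y → CommonNeighbour H x y → ¬ CommonNeighbour G x y → cherries G < cherries H
  cherries-<-ordered {G} {H} G⇒H x y lt cnH ¬cnG =
    countᵇ-mono-< pairs
      (λ { (x' , y') _ h → let (lt' , cn) = isCherry⁻ G h in isCherry⁺ H lt' (G⇒H x' y' (λ e → <-irrefl (cong toℕ e) lt') cn) })
      (∈-pairs x y) (isCherry-false G ¬cnG) (isCherry⁺ H lt cnH)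

  cherries-< : ∀ {G H} → CommonNeighbourMono G H →
               ∀ x y → (x ≡ y → ⊥) → CommonNeighbour H x y → ¬ CommonNeighbour G x y → cherries G < cherries H
  cherries-< G⇒H x y x≢y cnH ¬cnG with <-cmp (toℕ x) (toℕ y)
  ... | tri< lt _ _ = cherries-<-ordered G⇒H x y lt cnH ¬cnG
  ... | tri≈ _ eq _ = ⊥-elim (x≢y (toℕ-injective eq))
  ... | tri> _ _ gt = cherries-<-ordered G⇒H y x gt (common-neighbour-sym cnH) (¬cnG ∘ common-neighbour-sym)

module TreeFacts {m : ℕ} (G : LGraph m) (tr : IsTree G) where
  open IsTree tr
  open Cherries using (CommonNeighbour; common-neighbour)
  open Paths G
  open Degrees G
  open Reverse symmetric

  no-walk-between-neighbours : ∀ {u a b} → adj G u a ≡ true → adj G u b ≡ true → (a ≡ b → ⊥) → (w : Walk a b) → (u ∈ verts w → ⊥) → ⊥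
  no-walk-between-neighbours {u} {a} {b} ua ub a≢b w nu with shorten-walk w
  ... | [] , c , d , refl , sub = a≢b refl
  ... | y ∷ ys , c , d , l , sub =
    true≢false (trans (symmetric a u) ua)
        (acyclic a u (a ∷ y ∷ ys ++ u ∷ [])
           (isPath⁺ (y ∷ ys ++ u ∷ []) (chain-snoc a (y ∷ ys) u c (subst (λ z → adj G z u ≡ true) (sym l) (trans (symmetric b u) ub)))
                   (distinct-snoc (a ∷ y ∷ ys) u d (λ m → nu (sub u m))) (lastOf-snoc a (y ∷ ys) u))
           (s≤s (s≤s (length-snoc-pos ys))))

  components-not-joined : ∀ {u n1 n2 x y} → adj G u n1 ≡ true → adj G u n2 ≡ true → (n1 ≡ n2 → ⊥) →
             reachAvoiding G u n1 x ≡ true → reachAvoiding G u n2 y ≡ true →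
             (w : Walk x y) → (u ∈ verts w → ⊥) → ⊥
  components-not-joined {u} un1 un2 ne r1 r2 w nu =
    let (w1 , n1) = reachAvoiding⁻ r1
        (w2 , n2) = reachAvoiding⁻ r2
    in no-walk-between-neighbours un1 un2 ne (w1 ++w (w ++w wrev w2)) (λ m → f w1 n1 (w ++w wrev w2) (λ m' → f w nu (wrev w2) (λ m'' → n2 (∈-wrev w2 m'')) m') m)
    where
    f : ∀ {s t r} (w1 : Walk s t) → (u ∈ verts w1 → ⊥) → (w2 : Walk t r) → (u ∈ verts w2 → ⊥) → u ∈ verts (w1 ++w w2) → ⊥
    f w1 n1 w2 n2 m with ∈-++w w1 w2 m
    ... | inj₁ m' = n1 m'
    ... | inj₂ m' = n2 m'

  components-disjoint : ∀ {u n1 n2 x} → adj G u n1 ≡ true → adj G u n2 ≡ true → (n1 ≡ n2 → ⊥) →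
             reachAvoiding G u n1 x ≡ true → reachAvoiding G u n2 x ≡ true → ⊥
  components-disjoint un1 un2 ne r1 r2 = components-not-joined un1 un2 ne r1 r2 (wend _) (λ { (here refl) → reachAvoiding⇒≢ r1 refl })

  components-separated : ∀ {u n1 n2 x y} → adj G u n1 ≡ true → adj G u n2 ≡ true → (n1 ≡ n2 → ⊥) →
        reachAvoiding G u n1 x ≡ true → reachAvoiding G u n2 y ≡ true → onPath G u x y ≡ true
  components-separated {u} {x = x} {y} un1 un2 ne r1 r2 with connected x y
  ... | l , p = onPath⁺ l p (f (path⇒walk l p))
    where
    f : Σ (Walk x y) (λ w → verts w ≡ l) → u ∈ l
    f (w , refl) with true-or-false (elemF u (verts w))
    ... | inj₁ e = elemF⇒∈ (verts w) e
    ... | inj₂ e = ⊥-elim (components-not-joined un1 un2 ne r1 r2 w (λ m → true≢false (∈⇒elemF m) e))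

  component-of : ∀ {u v} → (u ≡ v → ⊥) → ∃ λ y → adj G u y ≡ true × reachAvoiding G u y v ≡ true
  component-of {u} {v} ne with connected u v
  ... | l , p with isPath⁻ l p
  ... | [] , refl , c , d , e = ⊥-elim (ne e)
  ... | y ∷ zs , refl , c , d , e with chain⇒walk y zs (∧-true⁻ʳ {adj G u y} c)
  ... | w , vw = y , ∧-true⁻ˡ {adj G u y} c ,
        subst (λ t → reachAvoiding G u y t ≡ true) e
          (reachAvoiding⁺ w (λ m → true≢false (∈⇒elemF (subst (u ∈_) vw m)) (not-true⁻ (∧-true⁻ˡ {not (elemF u (y ∷ zs))} d))))

  leaf-component : ∀ {u nb x} → degree G nb ≡ 1 → adj G u nb ≡ true → reachAvoiding G u nb x ≡ true → x ≡ nb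
  leaf-component {u} {nb} d un r with reachAvoiding⁻ r
  ... | wend _ , nu = refl
  ... | wstep {y = y} ny w , nu with degree1-neighbour-unique d (trans (symmetric nb u) un) ny
  ... | refl = ⊥-elim (nu (there (head∈ w)))

  no-chord : ∀ z y F' {w} → chain G (z ∷ y ∷ F') ≡ true → distinct G (z ∷ y ∷ F') ≡ true → w ∈ F' → adj G z w ≡ true → ⊥
  no-chord z y F' {w} c d m zw with ∈-∃++ m
  ... | M1 , M2 , refl = true≢false zw (acyclic z w L (isPath⁺ (y ∷ M1 ++ w ∷ []) (chain-prefix L M2 (subst (λ X → chain G X ≡ true) eq c))
                                     (distinct-prefix L M2 (subst (λ X → distinct G X ≡ true) eq d)) (lastOf-snoc z (y ∷ M1) w))
                                     (s≤s (s≤s (length-snoc-pos M1))))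
    where
    L = z ∷ y ∷ M1 ++ w ∷ []
    eq : z ∷ y ∷ M1 ++ w ∷ M2 ≡ L ++ M2
    eq = cong (λ X → z ∷ y ∷ X) (sym (LP.++-assoc M1 (w ∷ []) M2))

  adj⇒≢ : ∀ {x y} → adj G x y ≡ true → x ≡ y → ⊥
  adj⇒≢ {x} e refl = true≢false e (irreflexive x)

  reachAvoiding-self : ∀ {u nb} → adj G u nb ≡ true → reachAvoiding G u nb nb ≡ true
  reachAvoiding-self {u} {nb} un = reachAvoiding⁺ {u} (wend nb) (λ { (here e) → adj⇒≢ un e })

  join-through : ∀ {u n1 n2 x0 y1} X Y → isPath G x0 n1 X ≡ true → isPath G n2 y1 Y ≡ true →
         (∀ v → v ∈ X → reachAvoiding G u n1 v ≡ true) → (∀ v → v ∈ Y → reachAvoiding G u n2 v ≡ true) →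
         adj G u n1 ≡ true → adj G u n2 ≡ true → (n1 ≡ n2 → ⊥) → isPath G x0 y1 (X ++ u ∷ Y) ≡ true
  join-through {u} {n1} {n2} {x0} {y1} X Y pX pY rX rY un1 un2 ne with isPath⁻ X pX | isPath⁻ Y pY
  ... | xs , refl , c1 , d1 , l1 | ys , refl , c2 , d2 , l2 =
    isPath⁺ (xs ++ u ∷ n2 ∷ ys)
      (chain-++ x0 xs u (n2 ∷ ys) c1 (∧-true⁺ un2 c2) (subst (λ z → adj G z u ≡ true) (sym l1) (trans (symmetric n1 u) un1)))
      (distinct-++ (x0 ∷ xs) (u ∷ n2 ∷ ys) d1 (distinct-∷ u (n2 ∷ ys) (λ m → reachAvoiding⇒≢ (rY u m) refl) d2) disj)
      (trans (lastOf-++ x0 xs u (n2 ∷ ys)) l2)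
    where
    disj : ∀ {x} → x ∈ x0 ∷ xs → x ∈ u ∷ n2 ∷ ys → ⊥
    disj m1 (here refl) = reachAvoiding⇒≢ (rX _ m1) refl
    disj m1 (there m2) = components-disjoint un1 un2 ne (rX _ m1) (rY _ m2)

  component-path : ∀ {u nb x} → reachAvoiding G u nb x ≡ true →
             ∃ λ L → isPath G nb x L ≡ true × (∀ v → v ∈ L → reachAvoiding G u nb v ≡ true)
  component-path {u} {nb} {x} r with reachAvoiding⁻ {u} {nb} {x} r
  ... | w , nu with walk⇒path w
  ... | L , p , sub = L , p , λ v m → reachAvoiding-along-walk {u} w nu (sub v m)

  component-path′ : ∀ {u nb x} → reachAvoiding G u nb x ≡ true →
              ∃ λ L → isPath G x nb L ≡ true × (∀ v → v ∈ L → reachAvoiding G u nb v ≡ true)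
  component-path′ {u} {nb} {x} r with reachAvoiding⁻ {u} {nb} {x} r
  ... | w , nu with walk⇒path (wrev w)
  ... | L , p , sub = L , p , λ v m → reachAvoiding-along-walk {u} w nu (∈-wrev w (sub v m))

  two-taxa-beyond⇒degree3 : ∀ {u nb} {X : Fin m → Bool} → adj G u nb ≡ true →
                            (∀ x → X x ≡ reachAvoiding G u nb (leaf G x)) → 2 ≤ card X → degree G nb ≡ 3
  two-taxa-beyond⇒degree3 {u} {nb} {X} un comp h with degrees nb
  ... | inj₂ d = d
  ... | inj₁ d1 with countᵇ-pos⇒∃ {p = X} (allFin m) (≤-trans (s≤s z≤n) h)
  ... | x0 , _ , X0 = ⊥-elim (1+n≰n (≤-trans h (countᵇ-≤1 X x0 f)))
    where
    f : ∀ x → X x ≡ true → x ≡ x0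
    f x Xx = leaf-inj x x0 (trans (leaf-component d1 un (trans (sym (comp x)) Xx)) (sym (leaf-component d1 un (trans (sym (comp x0)) X0))))

  -- A longest path z y … c u ends in a leaf z; a third neighbour w of y starts another
  -- longest such path, so w is a leaf too and z, w form a cherry.
  module Branch {u c : V} (uc : adj G u c ≡ true) (degree-c : degree G c ≡ 3) where

    toU : List V → List V
    toU l = l ++ c ∷ u ∷ []

    isPathToU : List V → Bool
    isPathToU l = chain G (toU l) ∧ distinct G (toU l)

    Longest : List V → Set
    Longest l = ∀ l' → isPathToU l' ≡ true → length l' ≤ length l

    toU-shape : ∀ l → ∃ λ z → ∃ λ y → ∃ λ F' → toU l ≡ z ∷ y ∷ F'
    toU-shape [] = c , u , [] , refl
    toU-shape (z ∷ []) = z , c , u ∷ [] , refl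
    toU-shape (z ∷ y ∷ l) = z , y , l ++ c ∷ u ∷ [] , refl

    longest-starts-at-leaf : ∀ l → isPathToU l ≡ true → Longest l → ∀ {z y F'} → toU l ≡ z ∷ y ∷ F' → degree G z ≡ 1
    longest-starts-at-leaf l g M {z} {y} {F'} eq with degrees z
    ... | inj₁ d = d
    ... | inj₂ d3 with degree3-other-neighbour {x = y} d3
    ... | z' , zz' , z'y = ⊥-elim (1+n≰n (M (z' ∷ l) gz'))
      where
      c0 : chain G (z ∷ y ∷ F') ≡ true
      c0 = subst (λ X → chain G X ≡ true) eq (∧-true⁻ˡ {chain G (toU l)} g)
      d0 : distinct G (z ∷ y ∷ F') ≡ true
      d0 = subst (λ X → distinct G X ≡ true) eq (∧-true⁻ʳ {chain G (toU l)} g)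
      nm : z' ∈ z ∷ y ∷ F' → ⊥
      nm (here e) = adj⇒≢ zz' (sym e)
      nm (there (here e)) = z'y e
      nm (there (there m)) = no-chord z y F' c0 d0 m zz'
      gz' : isPathToU (z' ∷ l) ≡ true
      gz' = subst (λ X → (chain G (z' ∷ X) ∧ distinct G (z' ∷ X)) ≡ true) (sym eq)
              (∧-true⁺ (∧-true⁺ (trans (symmetric z' z) zz') c0) (distinct-∷ z' _ nm d0))

    pathToU-in-branch : ∀ l → isPathToU l ≡ true → ∀ {v} → v ∈ l → reachAvoiding G u c v ≡ true
    pathToU-in-branch (h ∷ l') g {v} m
      with chain⇒walk h (l' ++ c ∷ []) (chain-prefix (h ∷ l' ++ c ∷ []) (u ∷ []) (subst (λ X → chain G X ≡ true) eq (∧-true⁻ˡ {chain G (toU (h ∷ l'))} g)))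
      where
      eq : toU (h ∷ l') ≡ (h ∷ l' ++ c ∷ []) ++ u ∷ []
      eq = cong (h ∷_) (sym (LP.++-assoc l' (c ∷ []) (u ∷ [])))
    ... | w , vw with walk-suffix w (subst (v ∈_) (sym vw) (∈-++⁺ˡ m))
    ... | w' , sub = reachAvoiding⁺ (subst (λ t → Walk t v) (lastOf-snoc h l' c) (wrev w'))
                       (λ mu → nu (sub u (∈-wrev w' (subst-∈ (lastOf-snoc h l' c) (wrev w') mu))))
      where
      eq : toU (h ∷ l') ≡ (h ∷ l' ++ c ∷ []) ++ u ∷ []
      eq = cong (h ∷_) (sym (LP.++-assoc l' (c ∷ []) (u ∷ [])))
      nu : u ∈ verts w → ⊥
      nu mu = distinct-++-disjoint (h ∷ l' ++ c ∷ []) (u ∷ []) (subst (λ X → distinct G X ≡ true) eq (∧-true⁻ʳ {chain G (toU (h ∷ l'))} g))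
                (subst (u ∈_) vw mu) (here refl)
      subst-∈ : ∀ {t t' x} (e : t ≡ t') (w0 : Walk t x) → u ∈ verts (subst (λ t → Walk t x) e w0) → u ∈ verts w0
      subst-∈ refl w0 mu = mu

    isPathToU-[] : isPathToU [] ≡ true
    isPathToU-[] = ∧-true⁺ (∧-true⁺ (trans (symmetric c u) uc) refl) (distinct-∷ c (u ∷ []) (λ { (here e) → adj⇒≢ uc (sym e) }) refl)

    CherryInBranch : Set
    CherryInBranch = ∃ λ x → ∃ λ y → (x ≡ y → ⊥) ×
                     reachAvoiding G u c (leaf G x) ≡ true × reachAvoiding G u c (leaf G y) ≡ true ×
                     CommonNeighbour G x y

    cherry-at-longest : ∀ l → isPathToU l ≡ true → Longest l → CherryInBranch
    cherry-at-longest [] g M = ⊥-elim (degree1≢degree3 (longest-starts-at-leaf [] g M refl) degree-c refl)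
    cherry-at-longest (z ∷ l1) g M with toU-shape l1
    ... | y , y2 , F'' , e with degrees y
    ... | inj₁ d1 = ⊥-elim (zy2 (degree1-neighbour-unique d1 yz yy2))
      where
      c0 = subst (λ X → chain G X ≡ true) (cong (z ∷_) e) (∧-true⁻ˡ {chain G (toU (z ∷ l1))} g)
      d0 = subst (λ X → distinct G X ≡ true) (cong (z ∷_) e) (∧-true⁻ʳ {chain G (toU (z ∷ l1))} g)
      yz = trans (symmetric y z) (∧-true⁻ˡ {adj G z y} c0)
      yy2 = ∧-true⁻ˡ {adj G y y2} (∧-true⁻ʳ {adj G z y} c0)
      zy2 : z ≡ y2 → ⊥
      zy2 e' = distinct-head z (y ∷ y2 ∷ F'') d0 (there (here e'))
    ... | inj₂ d3 with degree3-third-neighbour {x = z} {y = y2} d3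
    ... | w , yw , wz , wy2 = xz , xw , (λ ex → wz (trans (sym lw) (trans (cong (leaf G) (sym ex)) lz))) ,
                               subst (λ X → reachAvoiding G u c X ≡ true) (sym lz) (pathToU-in-branch (z ∷ l1) g (here refl)) ,
                               subst (λ X → reachAvoiding G u c X ≡ true) (sym lw) (pathToU-in-branch (w ∷ l1) gw (here refl)) ,
                               common-neighbour y (subst (λ X → adj G y X ≡ true) (sym lz) yz) (subst (λ X → adj G y X ≡ true) (sym lw) yw)
      where
      c0 = subst (λ X → chain G X ≡ true) (cong (z ∷_) e) (∧-true⁻ˡ {chain G (toU (z ∷ l1))} g)
      d0 = subst (λ X → distinct G X ≡ true) (cong (z ∷_) e) (∧-true⁻ʳ {chain G (toU (z ∷ l1))} g)
      yz = trans (symmetric y z) (∧-true⁻ˡ {adj G z y} c0)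
      c1 = chain-tail z (y ∷ y2 ∷ F'') c0
      d1 = distinct-tail z (y ∷ y2 ∷ F'') d0
      nm : w ∈ y ∷ y2 ∷ F'' → ⊥
      nm (here e') = adj⇒≢ yw (sym e')
      nm (there (here e')) = wy2 e'
      nm (there (there m)) = no-chord y y2 F'' c1 d1 m yw
      gw : isPathToU (w ∷ l1) ≡ true
      gw = subst (λ X → (chain G (w ∷ X) ∧ distinct G (w ∷ X)) ≡ true) (sym e)
             (∧-true⁺ (∧-true⁺ (trans (symmetric w y) yw) c1) (distinct-∷ w (y ∷ y2 ∷ F'') nm d1))
      dz = longest-starts-at-leaf (z ∷ l1) g M (cong (z ∷_) e)
      dw = longest-starts-at-leaf (w ∷ l1) gw M (cong (w ∷_) e)
      xz = proj₁ (deg1-leaf z dz)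
      lz = proj₂ (deg1-leaf z dz)
      xw = proj₁ (deg1-leaf w dw)
      lw = proj₂ (deg1-leaf w dw)

    cherry-in-branch : CherryInBranch
    cherry-in-branch with argmax length isPathToU (candidates G) (distinct∈candidates [] refl) isPathToU-[]
    ... | lmax , _ , g , best = cherry-at-longest lmax g longest
      where
      longest : Longest lmax
      longest l' gl' = best l' (distinct∈candidates l' (distinct-prefix l' (c ∷ u ∷ []) (∧-true⁻ʳ {chain G (toU l')} gl'))) gl'

module Characters {m : ℕ} (G : LGraph m) (M : Char G) where

  inSpan⁻ : ∀ x v → inSpan G M x v ≡ true →
            ∃ λ s → ∃ λ t → rel G M x s ≡ true × rel G M x t ≡ true × onPath G v (leaf G s) (leaf G t) ≡ true
  inSpan⁻ x v e with any-true⁻ {p = λ s → any (λ t → rel G M x s ∧ rel G M x t ∧ onPath G v (leaf G s) (leaf G t)) (taxa G)} (taxa G) e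
  ... | s , _ , e2 with any-true⁻ {p = λ t → rel G M x s ∧ rel G M x t ∧ onPath G v (leaf G s) (leaf G t)} (taxa G) e2
  ... | t , _ , h = s , t , ∧-true⁻ˡ {rel G M x s} h , ∧-true⁻ˡ {rel G M x t} (∧-true⁻ʳ {rel G M x s} h) , ∧-true⁻ʳ {rel G M x t} (∧-true⁻ʳ {rel G M x s} h)

  inSpan⁺ : ∀ x v s t → rel G M x s ≡ true → rel G M x t ≡ true → onPath G v (leaf G s) (leaf G t) ≡ true →
            inSpan G M x v ≡ true
  inSpan⁺ x v s t r1 r2 o' =
    any-true⁺ {p = λ s → any (λ t → rel G M x s ∧ rel G M x t ∧ onPath G v (leaf G s) (leaf G t)) (taxa G)} (∈-allFin s)
      (any-true⁺ {p = λ t → rel G M x s ∧ rel G M x t ∧ onPath G v (leaf G s) (leaf G t)} (∈-allFin t) (∧-true⁺ r1 (∧-true⁺ r2 o')))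

  SpansDisjoint : Set
  SpansDisjoint = ∀ x y v → rel G M x y ≡ false → inSpan G M x v ≡ true → inSpan G M y v ≡ true → ⊥

  convex⇒spans-disjoint : isConvex G M ≡ true → SpansDisjoint
  convex⇒spans-disjoint cv x y v nr sx sy = true≢false (∧-true⁺ sx sy)
    (not-true⁻ (all-true⁻ (⇒ᵇ-true⁻ {not (rel G M x y)} (all-true⁻ (all-true⁻ cv (∈-allFin x)) (∈-allFin y)) (not-true⁺ nr)) (∈-allFin v)))

  spans-disjoint⇒convex : SpansDisjoint → isConvex G M ≡ true
  spans-disjoint⇒convex disj =
    all-true⁺ (taxa G) λ x _ → all-true⁺ (taxa G) λ y _ → ⇒ᵇ-true⁺ {not (rel G M x y)} λ nr →
      all-true⁺ (vertices G) λ v _ → not-true⁺ (both-false x y v (not-true⁻ nr))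
    where
    both-false : ∀ x y v → rel G M x y ≡ false → (inSpan G M x v ∧ inSpan G M y v) ≡ false
    both-false x y v nr with true-or-false (inSpan G M x v ∧ inSpan G M y v)
    ... | inj₁ e = ⊥-elim (disj x y v nr (∧-true⁻ˡ {inSpan G M x v} e) (∧-true⁻ʳ {inSpan G M x v} e))
    ... | inj₂ e = e

  module StateRelation (eqv : isEquivalence G M ≡ true) where

    rel-refl : ∀ x → rel G M x x ≡ true
    rel-refl x = all-true⁻ (∧-true⁻ˡ {all (λ x → rel G M x x) (taxa G)} eqv) (∈-allFin x)

    rel-sym : ∀ {x y} → rel G M x y ≡ true → rel G M y x ≡ true
    rel-sym {x} {y} e = ⇒ᵇ-true⁻ {rel G M x y}
      (all-true⁻ (all-true⁻ (∧-true⁻ˡ {all (λ x → all (λ y → rel G M x y ⇒ᵇ rel G M y x) (taxa G)) (taxa G)}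
                               (∧-true⁻ʳ {all (λ x → rel G M x x) (taxa G)} eqv)) (∈-allFin x)) (∈-allFin y)) e

    rel-trans : ∀ {x y z} → rel G M x y ≡ true → rel G M y z ≡ true → rel G M x z ≡ true
    rel-trans {x} {y} {z} e1 e2 = ⇒ᵇ-true⁻ {rel G M x y ∧ rel G M y z}
      (all-true⁻ (all-true⁻ (all-true⁻ (∧-true⁻ʳ {all (λ x → all (λ y → rel G M x y ⇒ᵇ rel G M y x) (taxa G)) (taxa G)}
                                         (∧-true⁻ʳ {all (λ x → rel G M x x) (taxa G)} eqv))
         (∈-allFin x)) (∈-allFin y)) (∈-allFin z)) (∧-true⁺ e1 e2)

    rel-sym-false : ∀ {x y} → rel G M x y ≡ false → rel G M y x ≡ false
    rel-sym-false {x} {y} e with true-or-false (rel G M y x)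
    ... | inj₁ e' = ⊥-elim (true≢false (rel-sym e') e)
    ... | inj₂ e' = e'

-- A path visits no vertex twice, so it crosses the boundary of a vertex set U with a single
-- boundary edge inner–outer at most once.
module SingleExit {m : ℕ} (G : LGraph m) (adj-sym : ∀ x y → adj G x y ≡ adj G y x)
            (U : Fin (n G) → Bool) (inner outer : Fin (n G)) (inner∈U : U inner ≡ true) (outer∉U : U outer ≡ false)
            (only-edge-out : ∀ w1 w2 → U w1 ≡ true → U w2 ≡ false → adj G w1 w2 ≡ true → w1 ≡ inner × w2 ≡ outer) where
  open Paths G

  first-exit : ∀ h hs → chain G (h ∷ hs) ≡ true → U h ≡ true → ∀ {e} → e ∈ h ∷ hs → U e ≡ false →
       ∃ λ L1 → ∃ λ L2 → h ∷ hs ≡ L1 ++ inner ∷ outer ∷ L2 × (∀ x → x ∈ L1 ++ inner ∷ [] → U x ≡ true)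
  first-exit h [] c Uh (here refl) Ue = ⊥-elim (true≢false Uh Ue)
  first-exit h (h2 ∷ hs) c Uh me Ue with true-or-false (U h2)
  ... | inj₂ U2 with only-edge-out h h2 Uh U2 (∧-true⁻ˡ {adj G h h2} c)
  ... | refl , refl = [] , hs , refl , λ { x (here refl) → inner∈U }
  first-exit h (h2 ∷ hs) c Uh (here refl) Ue | inj₁ U2 = ⊥-elim (true≢false Uh Ue)
  first-exit h (h2 ∷ hs) c Uh (there me) Ue | inj₁ U2 with first-exit h2 hs (∧-true⁻ʳ {adj G h h2} c) U2 me Ue
  ... | L1 , L2 , eq , allU = h ∷ L1 , L2 , cong (h ∷_) eq , λ { x (here refl) → Uh ; x (there mx) → allU x mx }

  first-entry : ∀ h hs → chain G (h ∷ hs) ≡ true → U h ≡ false → ∀ {e} → e ∈ h ∷ hs → U e ≡ true →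
       ∃ λ L1 → ∃ λ L2 → h ∷ hs ≡ L1 ++ outer ∷ inner ∷ L2 × (∀ x → x ∈ L1 ++ outer ∷ [] → U x ≡ false)
  first-entry h [] c Uh (here refl) Ue = ⊥-elim (true≢false Ue Uh)
  first-entry h (h2 ∷ hs) c Uh me Ue with true-or-false (U h2)
  ... | inj₁ U2 with only-edge-out h2 h U2 Uh (trans (adj-sym h2 h) (∧-true⁻ˡ {adj G h h2} c))
  ... | refl , refl = [] , hs , refl , λ { x (here refl) → outer∉U }
  first-entry h (h2 ∷ hs) c Uh (here refl) Ue | inj₂ U2 = ⊥-elim (true≢false Ue Uh)
  first-entry h (h2 ∷ hs) c Uh (there me) Ue | inj₂ U2 with first-entry h2 hs (∧-true⁻ʳ {adj G h h2} c) U2 me Ue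
  ... | L1 , L2 , eq , allU = h ∷ L1 , L2 , cong (h ∷_) eq , λ { x (here refl) → Uh ; x (there mx) → allU x mx }

  distinct-repeat : ∀ L1 x L2 → distinct G (L1 ++ x ∷ L2) ≡ true → x ∈ L2 → ⊥
  distinct-repeat L1 x L2 d m = distinct-head x L2 (distinct-suffix L1 x L2 d) m

  path-inside : ∀ h hs → chain G (h ∷ hs) ≡ true → distinct G (h ∷ hs) ≡ true → U h ≡ true → U (lastOf h hs) ≡ true →
       ∀ x → x ∈ h ∷ hs → U x ≡ true
  path-inside h hs c d Uh Ul x mx with true-or-false (U x)
  ... | inj₁ Ux = Ux
  ... | inj₂ Ux with first-exit h hs c Uh mx Ux
  ... | L1 , L2 , eq , allU with first-entry outer L2 (chain-tail inner (outer ∷ L2) (chain-suffix L1 inner (outer ∷ L2) (subst (λ X → chain G X ≡ true) eq c))) outer∉U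
                                     (subst (_∈ outer ∷ L2) (sym (lastOf-eq h hs L1 inner (outer ∷ L2) eq)) (lastOf-∈ outer L2)) Ul
  ... | M1 , M2 , eq2 , _ = ⊥-elim (distinct-repeat L1 inner (outer ∷ L2) (subst (λ X → distinct G X ≡ true) eq d)
                                 (subst (inner ∈_) (sym eq2) (∈-++⁺ʳ M1 (there (here refl)))))

  path-leaving : ∀ h hs → chain G (h ∷ hs) ≡ true → distinct G (h ∷ hs) ≡ true → U h ≡ true → U (lastOf h hs) ≡ false →
       ∀ {e} → e ∈ h ∷ hs → U e ≡ true →
       ∃ λ L1 → ∃ λ L2 → h ∷ hs ≡ L1 ++ inner ∷ outer ∷ L2 × (∀ x → x ∈ L1 ++ inner ∷ [] → U x ≡ true) × e ∈ L1 ++ inner ∷ []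
  path-leaving h hs c d Uh Ul {e} me Ue with first-exit h hs c Uh (lastOf-∈ h hs) Ul
  ... | L1 , L2 , eq , allU = L1 , L2 , eq , allU , locate-e (∈-++⁻ L1 (subst (e ∈_) eq me))
    where
    locate-e : e ∈ L1 ⊎ e ∈ inner ∷ outer ∷ L2 → e ∈ L1 ++ inner ∷ []
    locate-e (inj₁ m1) = ∈-++⁺ˡ m1
    locate-e (inj₂ (here refl)) = ∈-++⁺ʳ L1 (here refl)
    locate-e (inj₂ (there m2)) with first-entry outer L2 (chain-tail inner (outer ∷ L2) (chain-suffix L1 inner (outer ∷ L2) (subst (λ X → chain G X ≡ true) eq c))) outer∉U m2 Ue
    ... | M1 , M2 , eq2 , _ = ⊥-elim (distinct-repeat L1 inner (outer ∷ L2) (subst (λ X → distinct G X ≡ true) eq d)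
                                 (subst (inner ∈_) (sym eq2) (∈-++⁺ʳ M1 (there (here refl)))))

  path-entering : ∀ h hs → chain G (h ∷ hs) ≡ true → distinct G (h ∷ hs) ≡ true → U h ≡ false → U (lastOf h hs) ≡ true →
        ∀ {e} → e ∈ h ∷ hs → U e ≡ true →
        ∃ λ L1 → ∃ λ L2 → h ∷ hs ≡ L1 ++ outer ∷ inner ∷ L2 × (∀ x → x ∈ inner ∷ L2 → U x ≡ true) × e ∈ inner ∷ L2
  path-entering h hs c d Uh Ul {e} me Ue with first-entry h hs c Uh me Ue
  ... | L1 , L2 , eq , allO = L1 , L2 , eq , allU , locate-e (∈-++⁻ L1 (subst (e ∈_) eq me))
    where
    cg = chain-tail outer (inner ∷ L2) (chain-suffix L1 outer (inner ∷ L2) (subst (λ X → chain G X ≡ true) eq c))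
    dg = distinct-tail outer (inner ∷ L2) (distinct-suffix L1 outer (inner ∷ L2) (subst (λ X → distinct G X ≡ true) eq d))
    allU : ∀ x → x ∈ inner ∷ L2 → U x ≡ true
    allU = path-inside inner L2 cg dg inner∈U (subst (λ z → U z ≡ true) (lastOf-eq h hs L1 outer (inner ∷ L2) eq) Ul)
    locate-e : e ∈ L1 ⊎ e ∈ outer ∷ inner ∷ L2 → e ∈ inner ∷ L2
    locate-e (inj₁ m1) = ⊥-elim (true≢false Ue (allO e (∈-++⁺ˡ m1)))
    locate-e (inj₂ (here refl)) = ⊥-elim (true≢false Ue outer∉U)
    locate-e (inj₂ (there m2)) = m2

  path-outside : ∀ h hs → chain G (h ∷ hs) ≡ true → distinct G (h ∷ hs) ≡ true → U h ≡ false → U (lastOf h hs) ≡ false →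
       ∀ {e} → e ∈ h ∷ hs → U e ≡ true → ⊥
  path-outside h hs c d Uh Ul me Ue with first-entry h hs c Uh me Ue
  ... | L1 , L2 , eq , _ with first-exit inner L2 (chain-tail outer (inner ∷ L2) (chain-suffix L1 outer (inner ∷ L2) (subst (λ X → chain G X ≡ true) eq c))) inner∈U
                                  (subst (_∈ inner ∷ L2) (sym (lastOf-eq h hs L1 outer (inner ∷ L2) eq)) (lastOf-∈ inner L2)) Ul
  ... | M1 , M2 , eq2 , _ = distinct-repeat L1 outer (inner ∷ L2) (subst (λ X → distinct G X ≡ true) eq d)
                              (subst (outer ∈_) (sym eq2) (∈-++⁺ʳ M1 (there (here refl))))

module Linearization {m : ℕ} (T : LGraph m) (tr : IsTree T)
                     {u a b c : Fin (n T)} {A B C : Fin m → Bool}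
                     (ct : ContainsTripartition T u a b c A B C)
                     (cA : 2 ≤ card A) (cB : 2 ≤ card B) (cC : 2 ≤ card C)
                     {T' : LGraph m} (lin : IsLinearization T u a b C T') where
  open IsTree tr
  open ContainsTripartition ct
  open IsLinearization lin
  open TreeFacts T tr
  open Cherries
  open Paths T
  open Degrees T
  module G' = Paths T'
  open Reverse symmetric

  a≠b : a ≡ b → ⊥
  a≠b = =F-false⇒≢ a≢b
  a≠c : a ≡ c → ⊥
  a≠c = =F-false⇒≢ a≢c
  b≠c : b ≡ c → ⊥
  b≠c = =F-false⇒≢ b≢c

  degree-a : degree T a ≡ 3
  degree-a = two-taxa-beyond⇒degree3 adj-a A-comp cA
  degree-b : degree T b ≡ 3
  degree-b = two-taxa-beyond⇒degree3 adj-b B-comp cB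
  degree-c : degree T c ≡ 3
  degree-c = two-taxa-beyond⇒degree3 adj-c C-comp cC

  leaf≢u : ∀ x → leaf T x ≡ u → ⊥
  leaf≢u x = degree1≢degree3 (leaf-deg1 x) deg-u
  leaf≢a : ∀ x → leaf T x ≡ a → ⊥
  leaf≢a x = degree1≢degree3 (leaf-deg1 x) degree-a
  leaf≢b : ∀ x → leaf T x ≡ b → ⊥
  leaf≢b x = degree1≢degree3 (leaf-deg1 x) degree-b

  neighbour-of-u : ∀ {w} → adj T u w ≡ true → w ≡ a ⊎ w ≡ b ⊎ w ≡ c
  neighbour-of-u = degree3-neighbours deg-u adj-a adj-b adj-c a≠b a≠c b≠c

  outside-C⇒A⊎B : ∀ x → C x ≡ false → A x ≡ true ⊎ B x ≡ true
  outside-C⇒A⊎B x Cx with component-of {u} {leaf T x} (λ e → leaf≢u x (sym e))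
  ... | y , uy , r with neighbour-of-u uy
  ... | inj₁ refl = inj₁ (trans (A-comp x) r)
  ... | inj₂ (inj₁ refl) = inj₂ (trans (B-comp x) r)
  ... | inj₂ (inj₂ refl) = ⊥-elim (true≢false (trans (C-comp x) r) Cx)

  kept-leaf : ∀ x → C x ≡ false → K (leaf T x) ≡ true
  kept-leaf x Cx with outside-C⇒A⊎B x Cx
  ... | inj₁ Ax = ∨-true⁺ˡ (trans (sym (A-comp x)) Ax)
  ... | inj₂ Bx = ∨-true⁺ʳ {reachAvoiding T u a (leaf T x)} (trans (sym (B-comp x)) Bx)

  data Leaf′ (x : Fin m) : Set where
    old : C x ≡ false → leaf T' x ≡ φ (leaf T x) → Leaf′ x
    new : ∀ i → σ i ≡ x → leaf T' x ≡ q i → Leaf′ x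

  leaf′-kind : ∀ x → Leaf′ x
  leaf′-kind x with true-or-false (C x)
  ... | inj₂ Cx = old Cx (leaf'-old x Cx)
  ... | inj₁ Cx with σ-onto x Cx
  ... | i , refl = new i refl (leaf'-new i)

  adj′-q⇒p : ∀ w i → adj T' w (q i) ≡ true → w ≡ p i
  adj′-q⇒p w i e with cover w
  ... | inj₁ (v , Kv , refl) = ⊥-elim (true≢false e (adj'-φq v i Kv))
  ... | inj₂ (inj₁ (j , refl)) = cong p (=F⇒≡ {x = j} {y = i} (trans (sym (adj'-pq j i)) e))
  ... | inj₂ (inj₂ (j , refl)) = ⊥-elim (true≢false e (adj'-qq j i))

  adj′-φ-cases : ∀ w v → K v ≡ true → adj T' w (φ v) ≡ true →
                 (∃ λ v' → K v' ≡ true × w ≡ φ v' × adj T v' v ≡ true) ⊎ (v ≡ a ⊎ v ≡ b)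
  adj′-φ-cases w v Kv e with cover w
  ... | inj₁ (v' , Kv' , refl) = inj₁ (v' , Kv' , refl , trans (sym (adj'-φφ v' v Kv' Kv)) e)
  ... | inj₂ (inj₁ (j , refl)) with ∨-true⁻ {(v =F a) ∧ (toℕ j ≡ᵇ 0)} (trans (sym (adj'-φp v j Kv)) (trans (sym (adj'-sym (p j) (φ v))) e))
  ... | inj₁ h = inj₂ (inj₁ (=F⇒≡ {x = v} {y = a} (∧-true⁻ˡ {v =F a} h)))
  ... | inj₂ h = inj₂ (inj₂ (=F⇒≡ {x = v} {y = b} (∧-true⁻ˡ {v =F b} h)))
  adj′-φ-cases w v Kv e | inj₂ (inj₂ (j , refl)) = ⊥-elim (true≢false (trans (adj'-sym (φ v) (q j)) e) (adj'-φq v j Kv))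

  leaf≢a⊎b : ∀ z → leaf T z ≡ a ⊎ leaf T z ≡ b → ⊥
  leaf≢a⊎b z (inj₁ e) = leaf≢a z e
  leaf≢a⊎b z (inj₂ e) = leaf≢b z e

  p-not-adj-old-leaf : ∀ i z → C z ≡ false → adj T' (p i) (φ (leaf T z)) ≡ true → ⊥
  p-not-adj-old-leaf i z Cz e with adj′-φ-cases (p i) (leaf T z) (kept-leaf z Cz) e
  ... | inj₁ (v' , Kv' , eq , _) = φ≢p v' i Kv' (sym eq)
  ... | inj₂ s = leaf≢a⊎b z s

  new-leaves-common-neighbour′⇒≡ : ∀ i j → CommonNeighbour T' (σ i) (σ j) → i ≡ j
  new-leaves-common-neighbour′⇒≡ i j (common-neighbour w wi wj) =
    p-inj i j (trans (sym (adj′-q⇒p w i (subst (λ z → adj T' w z ≡ true) (leaf'-new i) wi)))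
                     (adj′-q⇒p w j (subst (λ z → adj T' w z ≡ true) (leaf'-new j) wj)))

  common-neighbour′⇒common-neighbour : CommonNeighbourMono T' T
  common-neighbour′⇒common-neighbour x y x≢y (common-neighbour w wx wy) = by-kind (leaf′-kind x) (leaf′-kind y)
    where
    by-kind : Leaf′ x → Leaf′ y → CommonNeighbour T x y
    by-kind (new i refl _) (new j refl _) = ⊥-elim (x≢y (cong σ (new-leaves-common-neighbour′⇒≡ i j (common-neighbour w wx wy))))
    by-kind (new i refl lx) (old Cy ly) with adj′-q⇒p w i (subst (λ z → adj T' w z ≡ true) lx wx)
    ... | refl = ⊥-elim (p-not-adj-old-leaf i y Cy (subst (λ z → adj T' (p i) z ≡ true) ly wy))
    by-kind (old Cx lx) (new j refl ly) with adj′-q⇒p w j (subst (λ z → adj T' w z ≡ true) ly wy)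
    ... | refl = ⊥-elim (p-not-adj-old-leaf j x Cx (subst (λ z → adj T' (p j) z ≡ true) lx wx))
    by-kind (old Cx lx) (old Cy ly)
      with adj′-φ-cases w (leaf T x) (kept-leaf x Cx) (subst (λ z → adj T' w z ≡ true) lx wx)
         | adj′-φ-cases w (leaf T y) (kept-leaf y Cy) (subst (λ z → adj T' w z ≡ true) ly wy)
    ... | inj₂ s | _ = ⊥-elim (leaf≢a⊎b x s)
    ... | inj₁ _ | inj₂ s = ⊥-elim (leaf≢a⊎b y s)
    ... | inj₁ (v1 , K1 , e1 , a1) | inj₁ (v2 , K2 , e2 , a2) with φ-inj v1 v2 K1 K2 (trans (sym e1) e2)
    ... | refl = common-neighbour v1 a1 a2

  C-common-neighbour′⇒≡ : ∀ x y → C x ≡ true → C y ≡ true → CommonNeighbour T' x y → x ≡ y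
  C-common-neighbour′⇒≡ x y Cx Cy cn with σ-onto x Cx | σ-onto y Cy
  ... | i , refl | j , refl = cong σ (new-leaves-common-neighbour′⇒≡ i j cn)

  cherry-in-C : ∃ λ x → ∃ λ y → C x ≡ true × C y ≡ true × (x ≡ y → ⊥) × CommonNeighbour T x y
  cherry-in-C with Branch.cherry-in-branch adj-c degree-c
  ... | x , y , x≢y , rx , ry , cn = x , y , trans (C-comp x) rx , trans (C-comp y) ry , x≢y , cn

  cherries-decrease : cherries T' < cherries T
  cherries-decrease with cherry-in-C
  ... | x , y , Cx , Cy , x≢y , cn =
    cherries-< common-neighbour′⇒common-neighbour x y x≢y cn (x≢y ∘ C-common-neighbour′⇒≡ x y Cx Cy)

  card-C-pos : 0 < card C
  card-C-pos = ≤-trans (s≤s z≤n) cC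
  pred[card-C]<card-C : pred (card C) < card C
  pred[card-C]<card-C = m≤pred[n]⇒suc[m]≤n {{>-nonZero card-C-pos}} ≤-refl

  first last : Fin (card C)
  first = fromℕ< card-C-pos
  last = fromℕ< pred[card-C]<card-C

  InImage : V → Fin (n T') → Bool
  InImage root w = any (λ v → reachAvoiding T u root v ∧ (φ v =F w)) (vertices T)

  InImage⁻ : ∀ root w → InImage root w ≡ true → ∃ λ v → reachAvoiding T u root v ≡ true × φ v ≡ w
  InImage⁻ root w e with any-true⁻ {p = λ v → reachAvoiding T u root v ∧ (φ v =F w)} (vertices T) e
  ... | v , _ , h = v , ∧-true⁻ˡ {reachAvoiding T u root v} h , =F⇒≡ {x = φ v} {y = w} (∧-true⁻ʳ {reachAvoiding T u root v} h)

  InImage⁺ : ∀ root {v} → reachAvoiding T u root v ≡ true → InImage root (φ v) ≡ true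
  InImage⁺ root {v} r = any-true⁺ {p = λ v' → reachAvoiding T u root v' ∧ (φ v' =F φ v)} (∈-allFin v) (∧-true⁺ r (≡⇒=F {x = φ v} refl))

  kept-if-reaches : ∀ {root v} → root ≡ a ⊎ root ≡ b → reachAvoiding T u root v ≡ true → K v ≡ true
  kept-if-reaches (inj₁ refl) r = ∨-true⁺ˡ r
  kept-if-reaches {v = v} (inj₂ refl) r = ∨-true⁺ʳ {reachAvoiding T u a v} r

  InImage-false : ∀ {root} → root ≡ a ⊎ root ≡ b → ∀ w → (∀ v → K v ≡ true → φ v ≡ w → ⊥) → InImage root w ≡ false
  InImage-false {root} s w f = any-false⁺ (vertices T) g0
    where
    g0 : ∀ v → v ∈ vertices T → (reachAvoiding T u root v ∧ (φ v =F w)) ≡ false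
    g0 v _ with true-or-false (reachAvoiding T u root v)
    ... | inj₂ e rewrite e = refl
    ... | inj₁ e rewrite e = ≢⇒=F-false (f v (kept-if-reaches s e))

  p∉image : ∀ {root} → root ≡ a ⊎ root ≡ b → ∀ i → InImage root (p i) ≡ false
  p∉image s i = InImage-false s (p i) (λ v Kv e → φ≢p v i Kv e)
  q∉image : ∀ {root} → root ≡ a ⊎ root ≡ b → ∀ i → InImage root (q i) ≡ false
  q∉image s i = InImage-false s (q i) (λ v Kv e → φ≢q v i Kv e)

  image-exit : ∀ {root other} → adj T u root ≡ true → adj T u other ≡ true → (root ≡ other → ⊥) → (root ≡ a ⊎ root ≡ b) →
            (∀ v → K v ≡ true → reachAvoiding T u root v ∨ reachAvoiding T u other v ≡ true) →
            ∀ w1 w2 → InImage root w1 ≡ true → InImage root w2 ≡ false → adj T' w1 w2 ≡ true →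
            ∃ λ v → reachAvoiding T u root v ≡ true × w1 ≡ φ v × ∃ λ j → w2 ≡ p j × adj T' (φ v) (p j) ≡ true
  image-exit {root} {other} un un' ne s Kside w1 w2 U1 U2 e with InImage⁻ root w1 U1
  ... | v , rv , refl with cover w2
  ... | inj₁ (v2 , K2 , refl) with ∨-true⁻ {reachAvoiding T u root v2} (Kside v2 K2)
  ...   | inj₁ r2 = ⊥-elim (true≢false (InImage⁺ root r2) U2)
  ...   | inj₂ r2 = ⊥-elim (components-not-joined un un' ne rv r2 (wstep (trans (sym (adj'-φφ v v2 (kept-if-reaches s rv) K2)) e) (wend _))
                      (λ { (here e') → reachAvoiding⇒≢ rv e' ; (there (here e')) → reachAvoiding⇒≢ r2 e' }))
  image-exit {root} {other} un un' ne s Kside w1 w2 U1 U2 e | v , rv , refl | inj₂ (inj₁ (j , refl)) = v , rv , refl , j , refl , e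
  image-exit {root} {other} un un' ne s Kside w1 w2 U1 U2 e | v , rv , refl | inj₂ (inj₂ (j , refl)) =
    ⊥-elim (true≢false e (adj'-φq v j (kept-if-reaches s rv)))

  record Side : Set where
    field
      root : V
      adj-root : adj T u root ≡ true
      root∈ab : root ≡ a ⊎ root ≡ b
      gate : Fin (n T')
      gate∉image : InImage root gate ≡ false
      only-exit : ∀ w1 w2 → InImage root w1 ≡ true → InImage root w2 ≡ false → adj T' w1 w2 ≡ true → w1 ≡ φ root × w2 ≡ gate

  exit-a : ∀ w1 w2 → InImage a w1 ≡ true → InImage a w2 ≡ false → adj T' w1 w2 ≡ true → w1 ≡ φ a × w2 ≡ p first
  exit-a w1 w2 U1 U2 e with image-exit adj-a adj-b a≠b (inj₁ refl) (λ v Kv → Kv) w1 w2 U1 U2 e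
  ... | v , rv , refl , j , refl , e' with ∨-true⁻ {(v =F a) ∧ (toℕ j ≡ᵇ 0)} (trans (sym (adj'-φp v j (kept-if-reaches (inj₁ refl) rv))) e')
  ... | inj₁ h = cong φ (=F⇒≡ {x = v} {y = a} (∧-true⁻ˡ {v =F a} h)) ,
                 cong p (toℕ-injective (trans (≡ᵇ-true⇒≡ (toℕ j) 0 (∧-true⁻ʳ {v =F a} h)) (sym (toℕ-fromℕ< card-C-pos))))
  ... | inj₂ h = ⊥-elim (components-disjoint adj-a adj-b a≠b rv
                   (subst (λ z → reachAvoiding T u b z ≡ true) (sym (=F⇒≡ {x = v} {y = b} (∧-true⁻ˡ {v =F b} h))) (reachAvoiding-self adj-b)))

  exit-b : ∀ w1 w2 → InImage b w1 ≡ true → InImage b w2 ≡ false → adj T' w1 w2 ≡ true → w1 ≡ φ b × w2 ≡ p last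
  exit-b w1 w2 U1 U2 e with image-exit adj-b adj-a (λ e → a≠b (sym e)) (inj₂ refl) (λ v Kv → f v Kv) w1 w2 U1 U2 e
    where
    f : ∀ v → K v ≡ true → (reachAvoiding T u b v ∨ reachAvoiding T u a v) ≡ true
    f v Kv with ∨-true⁻ {reachAvoiding T u a v} Kv
    ... | inj₁ r = ∨-true⁺ʳ {reachAvoiding T u b v} r
    ... | inj₂ r = ∨-true⁺ˡ r
  ... | v , rv , refl , j , refl , e' with ∨-true⁻ {(v =F a) ∧ (toℕ j ≡ᵇ 0)} (trans (sym (adj'-φp v j (kept-if-reaches (inj₂ refl) rv))) e')
  ... | inj₂ h = cong φ (=F⇒≡ {x = v} {y = b} (∧-true⁻ˡ {v =F b} h)) ,
                 cong p (toℕ-injective (trans (cong pred (≡ᵇ-true⇒≡ (suc (toℕ j)) (card C) (∧-true⁻ʳ {v =F b} h))) (sym (toℕ-fromℕ< pred[card-C]<card-C))))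
  ... | inj₁ h = ⊥-elim (components-disjoint adj-a adj-b a≠b
                   (subst (λ z → reachAvoiding T u a z ≡ true) (sym (=F⇒≡ {x = v} {y = a} (∧-true⁻ˡ {v =F a} h))) (reachAvoiding-self adj-a)) rv)

  side-a : Side
  side-a = record { root = a ; adj-root = adj-a ; root∈ab = inj₁ refl ; gate = p first ; gate∉image = p∉image (inj₁ refl) first ; only-exit = exit-a }
  side-b : Side
  side-b = record { root = b ; adj-root = adj-b ; root∈ab = inj₂ refl ; gate = p last ; gate∉image = p∉image (inj₂ refl) last ; only-exit = exit-b }

  module OnSide (S : Side) where
    open Side S
    root∈image : InImage root (φ root) ≡ true
    root∈image = InImage⁺ root (reachAvoiding-self adj-root)
    open SingleExit T' adj'-sym (InImage root) (φ root) gate root∈image gate∉image only-exit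

    c≢root : c ≡ root → ⊥
    c≢root with root∈ab
    ... | inj₁ refl = λ e → a≠c (sym e)
    ... | inj₂ refl = λ e → b≠c (sym e)

    leaf′-in-image : ∀ t → InImage root (leaf T' t) ≡ true → leaf T' t ≡ φ (leaf T t) × reachAvoiding T u root (leaf T t) ≡ true
    leaf′-in-image t U with leaf′-kind t
    ... | new i refl lt = ⊥-elim (true≢false (subst (λ z → InImage root z ≡ true) lt U) (q∉image root∈ab i))
    ... | old Ct lt with InImage⁻ root (leaf T' t) U
    ... | v , rv , e with φ-inj v (leaf T t) (kept-if-reaches root∈ab rv) (kept-leaf t Ct) (trans e lt)
    ... | refl = lt , rv

    not-root : ∀ {t nb} → C t ≡ false → InImage root (leaf T' t) ≡ false → reachAvoiding T u nb (leaf T t) ≡ true → nb ≡ root → ⊥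
    not-root {t} Ct U r refl = true≢false (subst (λ z → InImage root z ≡ true) (sym (leaf'-old t Ct)) (InImage⁺ root r)) U

    leaf′-outside-image : ∀ t → InImage root (leaf T' t) ≡ false →
                          ∃ λ n'' → adj T u n'' ≡ true × (n'' ≡ root → ⊥) × reachAvoiding T u n'' (leaf T t) ≡ true
    leaf′-outside-image t U with true-or-false (C t)
    ... | inj₁ Ct = c , adj-c , c≢root , trans (sym (C-comp t)) Ct
    ... | inj₂ Ct with outside-C⇒A⊎B t Ct
    ... | inj₁ At = a , adj-a , not-root Ct U (trans (sym (A-comp t)) At) , trans (sym (A-comp t)) At
    ... | inj₂ Bt = b , adj-b , not-root Ct U (trans (sym (B-comp t)) Bt) , trans (sym (B-comp t)) Bt

    preimage : ∀ L → (∀ x → x ∈ L → InImage root x ≡ true) → ∃ λ L0 → map φ L0 ≡ L × (∀ v → v ∈ L0 → reachAvoiding T u root v ≡ true)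
    preimage [] f = [] , refl , λ v ()
    preimage (x ∷ L) f with InImage⁻ root x (f x (here refl)) | preimage L (λ y m → f y (there m))
    ... | v , rv , refl | L0 , refl , rs = v ∷ L0 , refl , λ { y (here refl) → rv ; y (there m) → rs y m }

    chain-pullback : ∀ L0 → (∀ v → v ∈ L0 → K v ≡ true) → chain T' (map φ L0) ≡ true → chain T L0 ≡ true
    chain-pullback [] Ks c = refl
    chain-pullback (x ∷ []) Ks c = refl
    chain-pullback (x ∷ y ∷ L0) Ks c = ∧-true⁺ (trans (sym (adj'-φφ x y (Ks x (here refl)) (Ks y (there (here refl))))) (∧-true⁻ˡ {adj T' (φ x) (φ y)} c))
                                       (chain-pullback (y ∷ L0) (λ v m → Ks v (there m)) (∧-true⁻ʳ {adj T' (φ x) (φ y)} c))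

    distinct-pullback : ∀ L0 → distinct T' (map φ L0) ≡ true → distinct T L0 ≡ true
    distinct-pullback [] d = refl
    distinct-pullback (x ∷ L0) d = distinct-∷ x L0 (λ m → G'.distinct-head (φ x) (map φ L0) d (∈-map⁺ φ m)) (distinct-pullback L0 (G'.distinct-tail (φ x) (map φ L0) d))

    lastOf-map : ∀ h L0 → G'.lastOf (φ h) (map φ L0) ≡ φ (lastOf h L0)
    lastOf-map h [] = refl
    lastOf-map h (y ∷ L0) = lastOf-map y L0

    path-pullback : ∀ {v1 v2} L → K v1 ≡ true → K v2 ≡ true → isPath T' (φ v1) (φ v2) L ≡ true → (∀ x → x ∈ L → InImage root x ≡ true) →
           ∃ λ L0 → isPath T v1 v2 L0 ≡ true × (∀ v → v ∈ L0 → reachAvoiding T u root v ≡ true) × (∀ v → K v ≡ true → φ v ∈ L → v ∈ L0)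
    path-pullback {v1} {v2} L K1 K2 pth allU with preimage L allU
    ... | L0 , refl , rs = L0 , pullback-isPath L0 refl pth rs , rs , mem
      where
      mem : ∀ v → K v ≡ true → φ v ∈ map φ L0 → v ∈ L0
      mem v Kv m with ∈-map⁻ φ m
      ... | v' , m' , e = subst (_∈ L0) (sym (φ-inj v v' Kv (kept-if-reaches root∈ab (rs v' m')) e)) m'
      pullback-isPath : ∀ L1 → L1 ≡ L0 → isPath T' (φ v1) (φ v2) (map φ L1) ≡ true →
                        (∀ v → v ∈ L1 → reachAvoiding T u root v ≡ true) → isPath T v1 v2 L1 ≡ true
      pullback-isPath [] _ p' _ = ⊥-elim (true≢false p' refl)
      pullback-isPath (h0 ∷ L1) _ p' rs' with G'.isPath⁻ (map φ (h0 ∷ L1)) p'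
      ... | ys , eq , c' , d' , l' with φ-inj h0 v1 (kept-if-reaches root∈ab (rs' h0 (here refl))) K1 (cong hd eq)
        where
        hd : List (Fin (n T')) → Fin (n T')
        hd [] = φ v1
        hd (z ∷ _) = z
      ... | refl = isPath⁺ L1 (chain-pullback (h0 ∷ L1) (λ v m → kept-if-reaches root∈ab (rs' v m)) (G'.isPath⇒chain {s = φ v1} {t = φ v2} (map φ (h0 ∷ L1)) p'))
                     (distinct-pullback (h0 ∷ L1) (G'.isPath⇒distinct {s = φ v1} {t = φ v2} (map φ (h0 ∷ L1)) p'))
                     (φ-inj _ v2 (kept-if-reaches root∈ab (rs' _ (lastOf-∈ h0 L1))) K2
                        (trans (sym (lastOf-map h0 L1)) (subst (λ Y → G'.lastOf (φ h0) Y ≡ φ v2) (sym (cong tl eq)) l')))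
        where
        tl : List (Fin (n T')) → List (Fin (n T'))
        tl [] = []
        tl (_ ∷ z) = z

    kept-root : K root ≡ true
    kept-root = kept-if-reaches root∈ab (reachAvoiding-self adj-root)

    -- A T'-path through φ v either stays in the image and pulls back, or it leaves the image
    -- through the gate; then its pulled-back part continues through u to the other endpoint.
    onPath′⇒onPath : ∀ s t {v} → reachAvoiding T u root v ≡ true → ∀ L → isPath T' (leaf T' s) (leaf T' t) L ≡ true → φ v ∈ L →
               onPath T v (leaf T s) (leaf T t) ≡ true
    onPath′⇒onPath s t {v} rv L pth mv with G'.isPath⁻ L pth
    ... | ys , refl , c , d , l with true-or-false (InImage root (leaf T' s)) | true-or-false (InImage root (leaf T' t))
    ... | inj₁ Us | inj₁ Ut with leaf′-in-image s Us | leaf′-in-image t Ut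
    ... | ls , rs | lt , rt with path-pullback L (kept-if-reaches root∈ab rs) (kept-if-reaches root∈ab rt) (subst₂ (λ X Y → isPath T' X Y L ≡ true) ls lt pth)
                                  (path-inside (leaf T' s) ys c d Us (subst (λ z → InImage root z ≡ true) (sym l) Ut))
    ... | L0 , pT , _ , mem = onPath⁺ L0 pT (mem v (kept-if-reaches root∈ab rv) mv)
    onPath′⇒onPath s t {v} rv L pth mv | ys , refl , c , d , l | inj₁ Us | inj₂ Ut
      with path-leaving (leaf T' s) ys c d Us (subst (λ z → InImage root z ≡ false) (sym l) Ut) mv (InImage⁺ root rv)
    ... | L1 , L2 , eq , allU , mP with leaf′-in-image s Us
    ... | ls , rs with path-pullback (L1 ++ φ root ∷ []) (kept-if-reaches root∈ab rs) kept-root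
                           (subst (λ X → isPath T' X (φ root) (L1 ++ φ root ∷ []) ≡ true) ls (G'.prefix-isPath (leaf T' s) ys L1 (φ root) (gate ∷ L2) eq c d))
                           allU
    ... | L0 , pT , rs0 , mem with leaf′-outside-image t Ut
    ... | n'' , un'' , ne'' , rt'' with component-path {u} rt''
    ... | Y , pY , rY = onPath⁺ (L0 ++ u ∷ Y) (join-through L0 Y pT pY rs0 rY adj-root un'' (λ e → ne'' (sym e))) (∈-++⁺ˡ (mem v (kept-if-reaches root∈ab rv) mP))
    onPath′⇒onPath s t {v} rv L pth mv | ys , refl , c , d , l | inj₂ Us | inj₁ Ut
      with path-entering (leaf T' s) ys c d Us (subst (λ z → InImage root z ≡ true) (sym l) Ut) mv (InImage⁺ root rv)
    ... | L1 , L2 , eq , allU , mS with leaf′-in-image t Ut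
    ... | lt , rt with path-pullback (φ root ∷ L2) kept-root (kept-if-reaches root∈ab rt)
                          (subst (λ Y → isPath T' (φ root) Y (φ root ∷ L2) ≡ true) (trans l lt)
                             (G'.suffix-isPath (leaf T' s) ys (L1 ++ gate ∷ []) (φ root) L2 (trans eq (sym (LP.++-assoc L1 (gate ∷ []) (φ root ∷ L2)))) c d))
                          allU
    ... | L0 , pT , rs0 , mem with leaf′-outside-image s Us
    ... | n'' , un'' , ne'' , rs'' with component-path′ {u} rs''
    ... | X , pX , rX = onPath⁺ (X ++ u ∷ L0) (join-through X L0 pX pT rX rs0 un'' adj-root ne'') (∈-++⁺ʳ X (there (mem v (kept-if-reaches root∈ab rv) mS)))
    onPath′⇒onPath s t {v} rv L pth mv | ys , refl , c , d , l | inj₂ Us | inj₂ Ut =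
      ⊥-elim (path-outside (leaf T' s) ys c d Us (subst (λ z → InImage root z ≡ false) (sym l) Ut) mv (InImage⁺ root rv))

    path′-stays-in-image : ∀ s t → reachAvoiding T u root (leaf T s) ≡ true → reachAvoiding T u root (leaf T t) ≡ true →
             C s ≡ false → C t ≡ false → ∀ L → isPath T' (leaf T' s) (leaf T' t) L ≡ true → ∀ {w} → w ∈ L →
             ∃ λ v → reachAvoiding T u root v ≡ true × φ v ≡ w
    path′-stays-in-image s t rs rt Cs Ct L pth {w} mw with G'.isPath⁻ L pth
    ... | ys , refl , c , d , l =
      InImage⁻ root w (path-inside (leaf T' s) ys c d (subst (λ z → InImage root z ≡ true) (sym (leaf'-old s Cs)) (InImage⁺ root rs))
                    (subst (λ z → InImage root z ≡ true) (sym (trans l (leaf'-old t Ct))) (InImage⁺ root rt)) w mw)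

  module Convexity (k : ℕ) (Ck : card C < k) (M : Char T) (eqv : isEquivalence T M ≡ true)
                   (cv : isConvex T M ≡ true) (sz : statesAtLeast T k M ≡ true) where
    open Characters T M
    open StateRelation eqv
    module C' = Characters T' M

    R : Fin m → Fin m → Bool
    R = rel T M

    disjoint-in-T : SpansDisjoint
    disjoint-in-T = convex⇒spans-disjoint cv

    C-taxon-partner : ∀ z → C z ≡ true → ∃ λ x' → R z x' ≡ true × C x' ≡ false
    C-taxon-partner z Cz with countᵇ-<⇒∃ {p = R z} {q = C} (taxa T)
                        (≤-trans Ck (≤-pred (<ᵇ⇒< k (suc (countᵇ (R z) (taxa T))) (Equivalence.from T-≡ (all-true⁻ sz (∈-allFin z))))))
    ... | x' , _ , r , cx = x' , r , cx

    C-to-outside-through-u : ∀ s t → C s ≡ true → C t ≡ false → onPath T u (leaf T s) (leaf T t) ≡ true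
    C-to-outside-through-u s t Cs Ct with outside-C⇒A⊎B t Ct
    ... | inj₁ At = components-separated adj-c adj-a (λ e → a≠c (sym e)) (trans (sym (C-comp s)) Cs) (trans (sym (A-comp t)) At)
    ... | inj₂ Bt = components-separated adj-c adj-b (λ e → b≠c (sym e)) (trans (sym (C-comp s)) Cs) (trans (sym (B-comp t)) Bt)

    C-state-spans-u : ∀ z → C z ≡ true → inSpan T M z u ≡ true
    C-state-spans-u z Cz with C-taxon-partner z Cz
    ... | x' , r , cx = inSpan⁺ z u z x' (rel-refl z) r (C-to-outside-through-u z x' Cz cx)

    C-in-one-state : ∀ z z' → C z ≡ true → C z' ≡ true → R z z' ≡ true
    C-in-one-state z z' Cz Cz' with true-or-false (R z z')
    ... | inj₁ e = e
    ... | inj₂ e = ⊥-elim (disjoint-in-T z z' u e (C-state-spans-u z Cz) (C-state-spans-u z' Cz'))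

    someC : Fin m
    someC = proj₁ (countᵇ-pos⇒∃ {p = C} (allFin m) (≤-trans (s≤s z≤n) cC))
    C-someC : C someC ≡ true
    C-someC = proj₂ (proj₂ (countᵇ-pos⇒∃ {p = C} (allFin m) (≤-trans (s≤s z≤n) cC)))

    AvoidsC : Fin m → Set
    AvoidsC x = ∀ s → R x s ≡ true → C s ≡ false

    avoidsC? : ∀ x → AvoidsC x ⊎ ∃ λ z → R x z ≡ true × C z ≡ true
    avoidsC? x with true-or-false (any (λ s → R x s ∧ C s) (taxa T))
    ... | inj₁ e = let (z , _ , h) = any-true⁻ {p = λ s → R x s ∧ C s} (taxa T) e in inj₂ (z , ∧-true⁻ˡ {R x z} h , ∧-true⁻ʳ {R x z} h)
    ... | inj₂ e = inj₁ f
      where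
      f : AvoidsC x
      f s Rs with true-or-false (C s)
      ... | inj₁ Cs = ⊥-elim (true≢false (any-true⁺ {p = λ s → R x s ∧ C s} (∈-allFin s) (∧-true⁺ Rs Cs)) e)
      ... | inj₂ Cs = Cs

    avoidsC-on-one-side : ∀ x → AvoidsC x → (∀ s → R x s ≡ true → reachAvoiding T u a (leaf T s) ≡ true) ⊎
                                 (∀ s → R x s ≡ true → reachAvoiding T u b (leaf T s) ≡ true)
    avoidsC-on-one-side x cf with true-or-false (any (λ s → R x s ∧ A s) (taxa T))
    ... | inj₂ e = inj₂ f
      where
      f : ∀ s → R x s ≡ true → reachAvoiding T u b (leaf T s) ≡ true
      f s Rs with outside-C⇒A⊎B s (cf s Rs)
      ... | inj₁ As = ⊥-elim (true≢false (any-true⁺ {p = λ s → R x s ∧ A s} (∈-allFin s) (∧-true⁺ Rs As)) e)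
      ... | inj₂ Bs = trans (sym (B-comp s)) Bs
    ... | inj₁ e with any-true⁻ {p = λ s → R x s ∧ A s} (taxa T) e
    ... | s0 , _ , h = inj₁ f
      where
      nrz : R x someC ≡ false
      nrz with true-or-false (R x someC)
      ... | inj₁ r = ⊥-elim (true≢false C-someC (cf someC r))
      ... | inj₂ r = r
      f : ∀ t → R x t ≡ true → reachAvoiding T u a (leaf T t) ≡ true
      f t Rt with outside-C⇒A⊎B t (cf t Rt)
      ... | inj₁ At = trans (sym (A-comp t)) At
      ... | inj₂ Bt = ⊥-elim (disjoint-in-T x someC u nrz
                         (inSpan⁺ x u s0 t (∧-true⁻ˡ {R x s0} h) Rt
                            (components-separated adj-a adj-b a≠b (trans (sym (A-comp s0)) (∧-true⁻ʳ {R x s0} h)) (trans (sym (B-comp t)) Bt)))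
                         (C-state-spans-u someC C-someC))

    disjoint-on-side : (S : Side) → ∀ x y w → R x y ≡ false → inSpan T' M x w ≡ true → inSpan T' M y w ≡ true →
               (∀ s → R y s ≡ true → reachAvoiding T u (Side.root S) (leaf T s) ≡ true) → AvoidsC y → ⊥
    disjoint-on-side S x y w nr sx sy hy cfy with C'.inSpan⁻ y w sy
    ... | s , t , Rys , Ryt , op with G'.onPath⁻ {w} {leaf T' s} {leaf T' t} op
    ... | L , pth , mw with OnSide.path′-stays-in-image S s t (hy s Rys) (hy t Ryt) (cfy s Rys) (cfy t Ryt) L pth mw
    ... | v , rv , refl with C'.inSpan⁻ x (φ v) sx
    ... | s' , t' , Rxs' , Rxt' , op' with G'.onPath⁻ op'
    ... | L' , pth' , mw' =
      disjoint-in-T x y v nr (inSpan⁺ x v s' t' Rxs' Rxt' (OnSide.onPath′⇒onPath S s' t' rv L' pth' mw'))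
                      (inSpan⁺ y v s t Rys Ryt (OnSide.onPath′⇒onPath S s t rv L pth mw))

    disjoint-if-avoidsC : ∀ x y w → R x y ≡ false → inSpan T' M x w ≡ true → inSpan T' M y w ≡ true → AvoidsC y → ⊥
    disjoint-if-avoidsC x y w nr sx sy cfy with avoidsC-on-one-side y cfy
    ... | inj₁ hy = disjoint-on-side side-a x y w nr sx sy hy cfy
    ... | inj₂ hy = disjoint-on-side side-b x y w nr sx sy hy cfy

    spans′-disjoint : ∀ x y w → R x y ≡ false → inSpan T' M x w ≡ true → inSpan T' M y w ≡ true → ⊥
    spans′-disjoint x y w nr sx sy with avoidsC? y
    ... | inj₁ cfy = disjoint-if-avoidsC x y w nr sx sy cfy
    ... | inj₂ (z , Ryz , Cz) with avoidsC? x
    ... | inj₁ cfx = disjoint-if-avoidsC y x w (rel-sym-false nr) sy sx cfx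
    ... | inj₂ (z' , Rxz' , Cz') = true≢false (rel-trans Rxz' (rel-trans (C-in-one-state z' z Cz' Cz) (rel-sym Ryz))) nr

    convex′ : isConvex T' M ≡ true
    convex′ = C'.spans-disjoint⇒convex spans′-disjoint

  -- Being an equivalence and having large states only involve the taxa, not the tree.
  g-mono : ∀ k → card C < k → g T k ≤ g T' k
  g-mono k Ck = countᵇ-mono (allChars T) counted′
    where
    counted′ : ∀ M → M ∈ allChars T →
               (isEquivalence T M ∧ isConvex T M ∧ statesAtLeast T k M) ≡ true →
               (isEquivalence T' M ∧ isConvex T' M ∧ statesAtLeast T' k M) ≡ true
    counted′ M _ h = ∧-true⁺ eqv (∧-true⁺ (Convexity.convex′ k Ck M eqv cv sz) sz)
      where
      eqv = ∧-true⁻ˡ {isEquivalence T M} h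
      cv = ∧-true⁻ˡ {isConvex T M} (∧-true⁻ʳ {isEquivalence T M} h)
      sz = ∧-true⁻ʳ {isConvex T M} (∧-true⁻ʳ {isEquivalence T M} h)

lemma3p2 : (k m : ℕ) → 3 ≤ k →
           (T : LGraph m) → IsTree T →
           (u a b c : Fin (n T)) (A B C : Fin m → Bool) →
           ContainsTripartition T u a b c A B C →
           2 ≤ card A → 2 ≤ card B → 2 ≤ card C → card C < k →
           (T' : LGraph m) → IsLinearization T u a b C T' →
           (g T k ≤ g T' k) × (cherries T' < cherries T)
lemma3p2 k m _ T tree u a b c A B C ct cA cB cC Ck T' lin =
  g-mono k Ck , cherries-decrease
  where open Linearization T tree ct cA cB cC lin
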